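{- Let $G$ be a graph, $\mathcal{T}=(T,\lambda)$ a rooted rank decomposition of $G$, $T_{\mathrm{pref}}$ a leafless prefix of $T$, and $c,k$ positive integers. Then any minimal $c$-small $k$-closure of $T_{\mathrm{pref}}$ is linked.
   Context: $\mathrm{cutrk}_G(A)$ is the $\mathrm{GF}(2)$-rank of the adjacency matrix between $A$ and $V(G)\setminus A$. A rooted rank decomposition $(T,\lambda)$: $T$ a rooted binary tree (nodes have $0$ or $2$ children, root not a leaf), $\lambda$ a bijection from $V(G)$ to leaves; $\mathcal{L}(\mathcal{T})[t]$ = vertices mapped to leaves descending from $t$ (descendants include $t$ itself). A prefix is a node set inducing a connected subtree containing the root; leafless if it has no leaves; an appendix of $T_{\mathrm{pref}}$ is a node outside it with a neighbour in it. For a partition $\mathcal{C}$ of $V(G)$, $G[\mathcal{C}]$ keeps only edges of $G$ between different parts; the rankwidth of $(G[\mathcal{C}],\mathcal{C})$ is the minimum width of a rank decomposition (tree with non-leaf degree 3, bijection from $\mathcal{C}$ to leaves, edge width = $\mathrm{cutrk}_{G[\mathcal{C}]}$ of the union of parts on one side). A $k$-closure of $T_{\mathrm{pref}}$ is a partition $\mathcal{C}$ of $V(G)$ with each part contained in $\mathcal{L}(\mathcal{T})[a]$ for some appendix $a$, and $(G[\mathcal{C}],\mathcal{C})$ of rankwidth at most $2k$; it is $c$-small if each appendix $a$ has at most $c$ parts contained in $\mathcal{L}(\mathcal{T})[a]$. A set $C$ cuts node $t$ if both $\mathcal{L}(\mathcal{T})[t]\cap C$ and $\mathcal{L}(\mathcal{T})[t]\setminus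 C$ are nonempty; a closure cuts $t$ if some of its parts cuts $t$. A $c$-small $k$-closure is minimal if among all $c$-small $k$-closures of $T_{\mathrm{pref}}$ it primarily minimizes $\sum_{C\in\mathcal{C}}\mathrm{cutrk}_G(C)$ and secondarily minimizes the number of nodes of $T$ it cuts. For $A\subseteq B$, $A$ is linked into $B$ if $\mathrm{cutrk}_G(A)\le\mathrm{cutrk}_G(S)$ for all $S$ with $A\subseteq S\subseteq B$. A $k$-closure is linked if for every $C\in\mathcal{C}$ with $C\subseteq\mathcal{L}(\mathcal{T})[a]$ for an appendix $a$: $C$ is linked into $\mathcal{L}(\mathcal{T})[a]$, and whenever $C$ cuts a descendant $t$ of $a$, $\mathrm{cutrk}_G(C\cup\mathcal{L}(\mathcal{T})[t])>\mathrm{cutrk}_G(C)$. -}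

module Defs where

open import Data.Nat using (ℕ; zero; suc; _+_; _*_; _≤_; _<_; _⊔_)
open import Data.Bool using (Bool; true; false; _∧_; _∨_; not; _xor_; if_then_else_)
open import Data.Fin using (Fin; zero; suc; _≟_)
open import Data.List using (List; []; _∷_; _++_; map; foldr; concatMap)
open import Data.Product using (Σ; ∃; _×_; _,_)
open import Data.Sum using (_⊎_)
open import Relation.Binary.PropositionalEquality using (_≡_)
open import Relation.Nullary using (¬_; does)

anyF : ∀ {n} → (Fin n → Bool) → Bool
anyF {zero} f = false
anyF {suc n} f = f zero ∨ anyF (λ i → f (suc i))

allF : ∀ {n} → (Fin n → Bool) → Bool
allF {zero} f = true
allF {suc n} f = f zero ∧ allF (λ i → f (suc i))

xorF : ∀ {n} → (Fin n → Bool) → Bool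
xorF {zero} f = false
xorF {suc n} f = f zero xor xorF (λ i → f (suc i))

countF : ∀ {n} → (Fin n → Bool) → ℕ
countF {zero} f = 0
countF {suc n} f = (if f zero then 1 else 0) + countF (λ i → f (suc i))

sumF : ∀ {n} → (Fin n → ℕ) → ℕ
sumF {zero} f = 0
sumF {suc n} f = f zero + sumF (λ i → f (suc i))

VSet : ℕ → Set
VSet n = Fin n → Bool

_⊆_ : ∀ {n} → VSet n → VSet n → Set
A ⊆ B = ∀ v → A v ≡ true → B v ≡ true

_∪_ : ∀ {n} → VSet n → VSet n → VSet n
(A ∪ B) v = A v ∨ B v

subB : ∀ {n} → VSet n → VSet n → Bool
subB A B = allF (λ v → not (A v) ∨ B v)

consB : ∀ {n} → Bool → VSet n → VSet (suc n)
consB b s zero = b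
consB b s (suc i) = s i

subsets : ∀ n → List (VSet n)
subsets zero = (λ ()) ∷ []
subsets (suc n) = concatMap (λ s → consB false s ∷ consB true s ∷ []) (subsets n)

Mat : ℕ → Set
Mat n = Fin n → Fin n → Bool

-- a set R of rows is linearly independent over GF(2) iff no nonempty
-- subset R' ⊆ R of rows sums to the zero vector
independent : ∀ {n} → Mat n → VSet n → Bool
independent {n} M R =
  foldr (λ R' acc → acc ∧
           (not (subB R' R ∧ anyF R')
            ∨ anyF (λ col → xorF (λ u → R' u ∧ M u col))))
        true (subsets n)

rank : ∀ {n} → Mat n → ℕ
rank {n} M =
  foldr (λ R acc → if independent M R then countF R ⊔ acc else acc)
        0 (subsets n)

Adj : ℕ → Set
Adj n = Fin n → Fin n → Bool

record Graph (n : ℕ) : Set where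
  field
    E     : Adj n
    sym   : ∀ u v → E u v ≡ E v u
    irrefl : ∀ v → E v v ≡ false
open Graph public

-- cutrk of A w.r.t. adjacency E: GF(2)-rank of the A × (V∖A) adjacency
-- matrix (embedded into an n×n matrix padded with zeros)
cutrkA : ∀ {n} → Adj n → VSet n → ℕ
cutrkA E A = rank (λ u v → A u ∧ not (A v) ∧ E u v)

cutrk : ∀ {n} → Graph n → VSet n → ℕ
cutrk G A = cutrkA (E G) A

data BT (V : Set) : Set where
  lf : V → BT V
  nd : BT V → BT V → BT V

-- nodes of a tree, given as positions (paths from the root)
data Pos {V : Set} : BT V → Set where
  here : ∀ {t} → Pos t
  goL  : ∀ {l r} → Pos l → Pos (nd l r)
  goR  : ∀ {l r} → Pos r → Pos (nd l r)

sub : ∀ {V} {t : BT V} → Pos t → BT V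
sub {t = t} here = t
sub (goL p) = sub p
sub (goR p) = sub p

allPos : ∀ {V} (t : BT V) → List (Pos t)
allPos (lf v) = here ∷ []
allPos (nd l r) = here ∷ (map goL (allPos l) ++ map goR (allPos r))

data Child {V : Set} : {t : BT V} → Pos t → Pos t → Set where
  cL  : ∀ {l r} → Child {t = nd l r} (goL here) here
  cR  : ∀ {l r} → Child {t = nd l r} (goR here) here
  inL : ∀ {l r} {p q : Pos l} → Child p q → Child {t = nd l r} (goL p) (goL q)
  inR : ∀ {l r} {p q : Pos r} → Child p q → Child {t = nd l r} (goR p) (goR q)

-- Desc p q : p is a descendant of q (including p = q)
data Desc {V : Set} : {t : BT V} → Pos t → Pos t → Set where
  dHere : ∀ {t} {p : Pos t} → Desc p here
  dL    : ∀ {l r} {p q : Pos l} → Desc p q → Desc {t = nd l r} (goL p) (goL q)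
  dR    : ∀ {l r} {p q : Pos r} → Desc p q → Desc {t = nd l r} (goR p) (goR q)

IsLeaf : ∀ {V} {t : BT V} → Pos t → Set
IsLeaf {V} p = Σ V (λ v → sub p ≡ lf v)

occ : ∀ {n} → Fin n → BT (Fin n) → Bool
occ v (lf w) = does (v ≟ w)
occ v (nd l r) = occ v l ∨ occ v r

count : ∀ {n} → Fin n → BT (Fin n) → ℕ
count v (lf w) = if does (v ≟ w) then 1 else 0
count v (nd l r) = count v l + count v r

record RootedDecomp (n : ℕ) : Set where
  field
    T        : BT (Fin n)
    rootNode : Σ (BT (Fin n)) (λ l → Σ (BT (Fin n)) (λ r → T ≡ nd l r))
    -- λ is a bijection V(G) → leaves: every vertex labels exactly one leaf
    bij      : ∀ v → count v T ≡ 1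
open RootedDecomp public

Lv : ∀ {n} (𝒯 : RootedDecomp n) → Pos (T 𝒯) → VSet n
Lv 𝒯 p v = occ v (sub p)

-- Prefix: set of nodes containing the root, inducing a connected subtree
-- (for a rooted tree: closed under taking parents); leafless variant.
record LeaflessPrefix {n} (𝒯 : RootedDecomp n) : Set where
  field
    P        : Pos (T 𝒯) → Bool
    hasRoot  : P here ≡ true
    parentClosed : ∀ {c p} → Child c p → P c ≡ true → P p ≡ true
    leafless : ∀ p → P p ≡ true → ¬ IsLeaf p
open LeaflessPrefix public

Appendix : ∀ {n} {𝒯 : RootedDecomp n} → LeaflessPrefix 𝒯 → Pos (T 𝒯) → Set
Appendix {𝒯 = 𝒯} Tp a =
  P Tp a ≡ false × Σ (Pos (T 𝒯)) (λ b → (Child a b ⊎ Child b a) × P Tp b ≡ true)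

-- Partitions of V(G) = Fin n (parts are the nonempty fibres of `part`)

record Partition (n : ℕ) : Set where
  field
    m    : ℕ
    part : Fin n → Fin m
    surj : ∀ i → Σ (Fin n) (λ v → part v ≡ i)
open Partition public

cls : ∀ {n} (𝒞 : Partition n) → Fin (m 𝒞) → VSet n
cls 𝒞 i v = does (part 𝒞 v ≟ i)

quotAdj : ∀ {n} → Graph n → Partition n → Adj n
quotAdj G 𝒞 u v = E G u v ∧ not (does (part 𝒞 u ≟ part 𝒞 v))

-- A rank decomposition (cubic tree, leaves
-- in bijection with the parts) is encoded by a rooted binary tree obtained
-- by subdividing an edge: its edge cuts are exactly the leaf sets below
-- the nodes of the rooted tree.
RankwidthAtMost : ∀ {n} → Graph n → Partition n → ℕ → Set
RankwidthAtMost G 𝒞 w =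
  Σ (BT (Fin (m 𝒞))) λ D →
    (∀ i → count i D ≡ 1) ×
    (∀ (p : Pos D) → cutrkA (quotAdj G 𝒞) (λ v → occ (part 𝒞 v) (sub p)) ≤ w)

module _ {n} (G : Graph n) (𝒯 : RootedDecomp n) (Tp : LeaflessPrefix 𝒯) where

  IsClosure : ℕ → Partition n → Set
  IsClosure k 𝒞 =
    (∀ i → Σ (Pos (T 𝒯)) (λ a → Appendix Tp a × (cls 𝒞 i ⊆ Lv 𝒯 a)))
    × RankwidthAtMost G 𝒞 (2 * k)

  IsSmall : ℕ → Partition n → Set
  IsSmall c 𝒞 = ∀ a → Appendix Tp a →
    countF (λ i → subB (cls 𝒞 i) (Lv 𝒯 a)) ≤ c

  IsSmallClosure : ℕ → ℕ → Partition n → Set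
  IsSmallClosure c k 𝒞 = IsSmall c 𝒞 × IsClosure k 𝒞

  totalCut : Partition n → ℕ
  totalCut 𝒞 = sumF (λ i → cutrk G (cls 𝒞 i))

  cutsB : VSet n → Pos (T 𝒯) → Bool
  cutsB C t = anyF (λ v → Lv 𝒯 t v ∧ C v) ∧ anyF (λ v → Lv 𝒯 t v ∧ not (C v))

  closureCutsB : Partition n → Pos (T 𝒯) → Bool
  closureCutsB 𝒞 t = anyF (λ i → cutsB (cls 𝒞 i) t)

  nCut : Partition n → ℕ
  nCut 𝒞 = foldr (λ t acc → if closureCutsB 𝒞 t then suc acc else acc) 0 (allPos (T 𝒯))

  IsMinimalSmallClosure : ℕ → ℕ → Partition n → Set
  IsMinimalSmallClosure c k 𝒞 =
    IsSmallClosure c k 𝒞 ×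
    (∀ 𝒞' → IsSmallClosure c k 𝒞' →
       totalCut 𝒞 ≤ totalCut 𝒞' × (totalCut 𝒞 ≡ totalCut 𝒞' → nCut 𝒞 ≤ nCut 𝒞'))

  LinkedInto : VSet n → VSet n → Set
  LinkedInto A B = ∀ S → A ⊆ S → S ⊆ B → cutrk G A ≤ cutrk G S

  IsLinked : Partition n → Set
  IsLinked 𝒞 = ∀ i a → Appendix Tp a → cls 𝒞 i ⊆ Lv 𝒯 a →
    LinkedInto (cls 𝒞 i) (Lv 𝒯 a) ×
    (∀ t → Desc t a → cutsB (cls 𝒞 i) t ≡ true →
       cutrk G (cls 𝒞 i) < cutrk G (cls 𝒞 i ∪ Lv 𝒯 t))

{-# OPTIONS --safe #-}
module Submission where

-- Let C be a part lying in 𝒯[a] for an appendix a.  Replace C by a set S with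
-- C ⊆ S ⊆ 𝒯[a] of minimum cut-rank, every other part X by X ∖ S, and drop the
-- parts that become empty.  By submodularity and symmetry of the cut-rank,
-- cutrk (U ∪ S) ≤ cutrk U when C ⊆ U, and cutrk (U ∖ S) ≤ cutrk U when U misses C.
-- Every union of parts below a node of the decomposition of (G[𝒞], 𝒞) becomes
-- a set of one of these two kinds, and every nonempty new part stays in the
-- appendix of the old one, so the result is again a c-small k-closure whose total
-- cut-rank is at most the old one plus cutrk S − cutrk C.  Minimality thus forces
-- cutrk C ≤ cutrk S, i.e. C is linked into 𝒯[a].  If C cuts a node t below a and
-- cutrk (C ∪ 𝒯[t]) ≤ cutrk C, then S = C ∪ 𝒯[t] is such a minimiser: the total
-- cut-rank is unchanged, while t is no longer cut and no new node is, against the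
-- secondary minimality.  Submodularity of the cut-rank is submodularity of the
-- GF(2) rank of sets of rows, applied to the unit vectors stacked on the columns
-- of the adjacency matrix.

open import Defs hiding (sym)
open import Algebra.Bundles using (CommutativeRing)
import Algebra.Properties.CommutativeSemigroup as CommSemigroupProperties
open import Data.Bool using (Bool; true; false; _∧_; _∨_; not; _xor_; if_then_else_)
import Data.Bool as Bool
open import Data.Bool.Properties
  using (∧-assoc; ∧-comm; ∧-zeroʳ; ∧-identityʳ; ∨-identityʳ; ∨-zeroʳ; ∧-distribˡ-xor; ∧-distribʳ-xor;
         xor-identityʳ; xor-same; not-¬; ¬-not; not-involutive; xor-∧-commutativeRing; ∨-∧-booleanAlgebra)
open import Algebra.Lattice.Properties.BooleanAlgebra ∨-∧-booleanAlgebra using (deMorgan₁; deMorgan₂)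
open import Data.Empty using (⊥; ⊥-elim)
open import Data.Fin using (Fin; zero; suc; _≟_; punchIn; punchOut; splitAt; _↑ˡ_; _↑ʳ_)
open import Data.Fin.Properties
  using (punchIn-injective; punchInᵢ≢i; punchIn-punchOut; any?; all?; ¬∀⟶∃¬;
         splitAt-↑ˡ; splitAt-↑ʳ; splitAt⁻¹-↑ˡ; splitAt⁻¹-↑ʳ)
open import Data.List using (List; []; _∷_; map; foldr; filter)
open import Data.List.Extrema.Nat using (argmin; argmin-all; f[argmin]≤f[xs])
open import Data.List.Membership.Propositional using (_∈_; find)
open import Data.List.Membership.Propositional.Properties using (∈-map⁺; ∈-++⁺ˡ; ∈-++⁺ʳ; ∈-filter⁺)
open import Data.List.Relation.Unary.All using (All; []; _∷_; lookup; lookupAny)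
open import Data.List.Relation.Unary.All.Properties using (all-filter)
open import Data.List.Relation.Unary.Any using (Any; here; there)
import Data.List.Relation.Unary.Any as Any
open import Data.List.Relation.Unary.Any.Properties using (concatMap⁺)
open import Data.Maybe using (Maybe; just; nothing)
open import Data.Nat using (ℕ; zero; suc; _+_; _*_; _∸_; _≤_; _<_; _⊔_; z≤n; s≤s; z<s)
open import Data.Nat.Induction using (<-wellFounded)
open import Data.Nat.Properties
  using (≤-refl; ≤-reflexive; ≤-trans; ≤-antisym; <-irrefl; <⇒≱; ≰⇒>; n<1+n; m≤n⇒m≤1+n;
         m≤m+n; m≤n+m; m<m+n; m≤m⊔n; m≤n⊔m; ⊔-sel; m+[n∸m]≡n; +-identityʳ; +-suc; +-assoc; +-comm;
         +-mono-≤; +-monoˡ-≤; +-monoʳ-≤; +-cancelˡ-≤; +-cancelʳ-≤; +-commutativeSemigroup; module ≤-Reasoning)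
open import Data.Product using (Σ; _×_; _,_; proj₁; proj₂)
open import Data.Sum using (_⊎_; inj₁; inj₂; [_,_])
import Data.Sum as Sum
open import Data.Vec.Functional using (_++_)
open import Function using (_∘_; id)
open import Function.Bundles using (mk⇔)
open import Induction.WellFounded using (Acc; acc)
open import Relation.Binary.PropositionalEquality
  using (_≡_; _≢_; refl; sym; trans; cong; cong₂; subst; module ≡-Reasoning)
open import Relation.Nullary using (¬_; does; yes; no)
open import Relation.Nullary.Decidable using (dec-true; dec-false; does-⇔)

private
  variable
    a b b′ n : ℕ

∧-elimˡ : ∀ {x y} → x ∧ y ≡ true → x ≡ true
∧-elimˡ {true} _ = refl

∧-elimʳ : ∀ {x y} → x ∧ y ≡ true → y ≡ true
∧-elimʳ {true} y≡true = y≡true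

∧-intro : ∀ {x y} → x ≡ true → y ≡ true → x ∧ y ≡ true
∧-intro refl refl = refl

∨-elim : ∀ {x y} → x ∨ y ≡ true → x ≡ true ⊎ y ≡ true
∨-elim {true} _ = inj₁ refl
∨-elim {false} y≡true = inj₂ y≡true

∨-introˡ : ∀ {x y} → x ≡ true → x ∨ y ≡ true
∨-introˡ refl = refl

∨-introʳ : ∀ {x y} → y ≡ true → x ∨ y ≡ true
∨-introʳ {true} _ = refl
∨-introʳ {false} y≡true = y≡true

∨-falseˡ : ∀ {x y} → x ∨ y ≡ false → x ≡ false
∨-falseˡ {false} _ = refl

∨-falseʳ : ∀ {x y} → x ∨ y ≡ false → y ≡ false
∨-falseʳ {false} y≡false = y≡false

not-true : ∀ {x} → not x ≡ true → x ≡ false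
not-true {false} _ = refl

not-false : ∀ {x} → x ≡ false → not x ≡ true
not-false refl = refl

true≢false : ∀ {x} → x ≡ true → x ≡ false → ⊥
true≢false x≡true = not-¬ x≡true

≢true : ∀ {x} → ¬ x ≡ true → x ≡ false
≢true = ¬-not

xor-interchange : ∀ a b c d → (a xor b) xor (c xor d) ≡ (a xor c) xor (b xor d)
xor-interchange = CommSemigroupProperties.interchange
  (CommutativeRing.+-commutativeSemigroup xor-∧-commutativeRing)

+-interchange : ∀ a b c d → (a + b) + (c + d) ≡ (a + c) + (b + d)
+-interchange = CommSemigroupProperties.interchange +-commutativeSemigroup

_==_ : Fin n → Fin n → Bool
i == j = does (i ≟ j)

==-refl : (i : Fin n) → (i == i) ≡ true
==-refl i = dec-true (i ≟ i) refl

==⇒≡ : {i j : Fin n} → (i == j) ≡ true → i ≡ j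
==⇒≡ {i = i} {j} e with i ≟ j
... | yes i≡j = i≡j

≢⇒==-false : {i j : Fin n} → i ≢ j → (i == j) ≡ false
≢⇒==-false {i = i} {j} = dec-false (i ≟ j)

anyF⁺ : (f : Fin n → Bool) (i : Fin n) → f i ≡ true → anyF f ≡ true
anyF⁺ f zero fi = ∨-introˡ fi
anyF⁺ f (suc i) fi = ∨-introʳ {f zero} (anyF⁺ (f ∘ suc) i fi)

anyF⁻ : (f : Fin n → Bool) → anyF f ≡ true → Σ (Fin n) (λ i → f i ≡ true)
anyF⁻ {suc n} f e with ∨-elim {f zero} e
... | inj₁ f0 = zero , f0
... | inj₂ rest = let i , fi = anyF⁻ (f ∘ suc) rest in suc i , fi

anyF-false⁻ : (f : Fin n → Bool) → anyF f ≡ false → ∀ i → f i ≡ false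
anyF-false⁻ f e i = ≢true (λ fi → true≢false (anyF⁺ f i fi) e)

allF-cong : {f g : Fin n → Bool} → (∀ i → f i ≡ g i) → allF f ≡ allF g
allF-cong {zero} f≗g = refl
allF-cong {suc n} f≗g = cong₂ _∧_ (f≗g zero) (allF-cong (f≗g ∘ suc))

allF⁺ : (f : Fin n → Bool) → (∀ i → f i ≡ true) → allF f ≡ true
allF⁺ {zero} f _ = refl
allF⁺ {suc n} f all = ∧-intro (all zero) (allF⁺ (f ∘ suc) (all ∘ suc))

allF⁻ : (f : Fin n → Bool) → allF f ≡ true → ∀ i → f i ≡ true
allF⁻ f e zero = ∧-elimˡ e
allF⁻ f e (suc i) = allF⁻ (f ∘ suc) (∧-elimʳ {f zero} e) i

subB⁺ : (A B : VSet n) → A ⊆ B → subB A B ≡ true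
subB⁺ A B A⊆B = allF⁺ _ pointwise
  where
  pointwise : ∀ v → not (A v) ∨ B v ≡ true
  pointwise v with A v in Av
  ... | true = A⊆B v Av
  ... | false = refl

subB⁻ : (A B : VSet n) → subB A B ≡ true → A ⊆ B
subB⁻ A B e v Av with allF⁻ _ e v
... | pointwise rewrite Av = pointwise

xorF-cong : {f g : Fin n → Bool} → (∀ i → f i ≡ g i) → xorF f ≡ xorF g
xorF-cong {zero} f≗g = refl
xorF-cong {suc n} f≗g = cong₂ _xor_ (f≗g zero) (xorF-cong (f≗g ∘ suc))

xorF-false : (f : Fin n → Bool) → (∀ i → f i ≡ false) → xorF f ≡ false
xorF-false {zero} f _ = refl
xorF-false {suc n} f none rewrite none zero = xorF-false (f ∘ suc) (none ∘ suc)

xorF⁻ : (f : Fin n → Bool) → xorF f ≡ true → Σ (Fin n) (λ i → f i ≡ true)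
xorF⁻ {suc n} f e with f zero in f0
... | true = zero , f0
... | false = let i , fi = xorF⁻ (f ∘ suc) e in suc i , fi

xorF-xor : (f g : Fin n → Bool) → xorF (λ i → f i xor g i) ≡ xorF f xor xorF g
xorF-xor {zero} f g = refl
xorF-xor {suc n} f g =
  trans (cong ((f zero xor g zero) xor_) (xorF-xor (f ∘ suc) (g ∘ suc)))
        (xor-interchange (f zero) (g zero) _ _)

∧-xorFˡ : ∀ b (f : Fin n → Bool) → b ∧ xorF f ≡ xorF (λ i → b ∧ f i)
∧-xorFˡ {zero} b f = ∧-zeroʳ b
∧-xorFˡ {suc n} b f =
  trans (∧-distribˡ-xor b (f zero) _) (cong ((b ∧ f zero) xor_) (∧-xorFˡ b (f ∘ suc)))

∧-xorFʳ : ∀ b (f : Fin n → Bool) → xorF f ∧ b ≡ xorF (λ i → f i ∧ b)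
∧-xorFʳ b f = trans (∧-comm (xorF f) b)
  (trans (∧-xorFˡ b f) (xorF-cong (λ i → ∧-comm b (f i))))

xorF-swap : ∀ {m} (F : Fin m → Fin n → Bool) →
  xorF (λ i → xorF (F i)) ≡ xorF (λ j → xorF (λ i → F i j))
xorF-swap {n} {m = zero} F = sym (xorF-false {n} _ (λ _ → refl))
xorF-swap {m = suc m} F =
  trans (cong (xorF (F zero) xor_) (xorF-swap (F ∘ suc)))
        (sym (xorF-xor (F zero) (λ j → xorF (λ i → F (suc i) j))))

xorF-select : (z : Fin n) (g : Fin n → Bool) → xorF (λ u → g u ∧ (u == z)) ≡ g z
xorF-select {suc n} zero g =
  trans (cong ((g zero ∧ true) xor_) (xorF-false _ (λ i → ∧-zeroʳ (g (suc i)))))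
        (trans (xor-identityʳ _) (∧-identityʳ (g zero)))
xorF-select {suc n} (suc z) g =
  trans (cong (_xor xorF (λ i → g (suc i) ∧ (i == z))) (∧-zeroʳ (g zero)))
        (xorF-select z (g ∘ suc))

countF-cong : {f g : Fin n → Bool} → (∀ i → f i ≡ g i) → countF f ≡ countF g
countF-cong {zero} f≗g = refl
countF-cong {suc n} f≗g rewrite f≗g zero = cong (_ +_) (countF-cong (f≗g ∘ suc))

countF-zero : (f : Fin n → Bool) → (∀ i → f i ≡ false) → countF f ≡ 0
countF-zero {zero} f _ = refl
countF-zero {suc n} f none rewrite none zero = countF-zero (f ∘ suc) (none ∘ suc)

countF-mono : (f g : Fin n → Bool) → (∀ i → f i ≡ true → g i ≡ true) → countF f ≤ countF g
countF-mono {zero} f g _ = z≤n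
countF-mono {suc n} f g f⇒g with f zero in f0 | g zero in g0
... | true | true = s≤s (countF-mono (f ∘ suc) (g ∘ suc) (f⇒g ∘ suc))
... | true | false = ⊥-elim (true≢false (f⇒g zero f0) g0)
... | false | true = m≤n⇒m≤1+n (countF-mono (f ∘ suc) (g ∘ suc) (f⇒g ∘ suc))
... | false | false = countF-mono (f ∘ suc) (g ∘ suc) (f⇒g ∘ suc)

countF-pos : (f : Fin n → Bool) (i : Fin n) → f i ≡ true → 1 ≤ countF f
countF-pos f zero fi rewrite fi = s≤s z≤n
countF-pos f (suc i) fi with f zero
... | true = s≤s z≤n
... | false = countF-pos (f ∘ suc) i fi

countF-remove : (f : Fin n → Bool) (k : Fin n) → f k ≡ true →
  countF f ≡ suc (countF (λ i → f i ∧ not (i == k)))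
countF-remove {suc n} f zero fk rewrite fk =
  cong suc (countF-cong (λ i → sym (∧-identityʳ (f (suc i)))))
countF-remove {suc n} f (suc k) fk with f zero
... | true = cong suc (countF-remove (f ∘ suc) k fk)
... | false = countF-remove (f ∘ suc) k fk

countF-∪-∩ : (f g : Fin n → Bool) →
  countF f + countF g ≡ countF (λ i → f i ∨ g i) + countF (λ i → f i ∧ g i)
countF-∪-∩ {zero} f g = refl
countF-∪-∩ {suc n} f g with f zero | g zero | countF-∪-∩ (f ∘ suc) (g ∘ suc)
... | true | true | ih = cong suc (trans (+-suc _ _) (trans (cong suc ih) (sym (+-suc _ _))))
... | true | false | ih = cong suc ih
... | false | true | ih = trans (+-suc _ _) (cong suc ih)
... | false | false | ih = ih

countF≡sumF : (f : Fin n → Bool) → countF f ≡ sumF (λ i → if f i then 1 else 0)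
countF≡sumF {zero} f = refl
countF≡sumF {suc n} f = cong ((if f zero then 1 else 0) +_) (countF≡sumF (f ∘ suc))

sumF-cong : {f g : Fin n → ℕ} → (∀ i → f i ≡ g i) → sumF f ≡ sumF g
sumF-cong {zero} f≗g = refl
sumF-cong {suc n} f≗g = cong₂ _+_ (f≗g zero) (sumF-cong (f≗g ∘ suc))

sumF-mono : (f g : Fin n → ℕ) → (∀ i → f i ≤ g i) → sumF f ≤ sumF g
sumF-mono {zero} f g _ = z≤n
sumF-mono {suc n} f g f≤g = +-mono-≤ (f≤g zero) (sumF-mono (f ∘ suc) (g ∘ suc) (f≤g ∘ suc))

sumF-punchIn : (g : Fin (suc n) → ℕ) (i : Fin (suc n)) → sumF g ≡ g i + sumF (g ∘ punchIn i)
sumF-punchIn g zero = refl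
sumF-punchIn {suc n} g (suc i) = begin
  g zero + sumF (g ∘ suc)                ≡⟨ cong (g zero +_) (sumF-punchIn (g ∘ suc) i) ⟩
  g zero + (g (suc i) + rest)            ≡⟨ sym (+-assoc (g zero) _ _) ⟩
  g zero + g (suc i) + rest              ≡⟨ cong (_+ rest) (+-comm (g zero) _) ⟩
  g (suc i) + g zero + rest              ≡⟨ +-assoc (g (suc i)) _ _ ⟩
  g (suc i) + (g zero + rest)            ∎
  where
  open ≡-Reasoning
  rest : ℕ
  rest = sumF (g ∘ suc ∘ punchIn i)

sumF-replace : ∀ {m} (F H : Fin m → ℕ) (i : Fin m) → (∀ j → j ≢ i → F j ≤ H j) →
  sumF F + H i ≤ sumF H + F i
sumF-replace {suc m} F H i F≤H = begin
  sumF F + H i                          ≡⟨ cong (_+ H i) (sumF-punchIn F i) ⟩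
  F i + sumF (F ∘ punchIn i) + H i
    ≤⟨ +-monoˡ-≤ (H i) (+-monoʳ-≤ (F i) (sumF-mono _ _ (λ j → F≤H (punchIn i j) (punchInᵢ≢i i j)))) ⟩
  F i + sumF (H ∘ punchIn i) + H i       ≡⟨ +-comm (F i + _) (H i) ⟩
  H i + (F i + sumF (H ∘ punchIn i))     ≡⟨ cong (H i +_) (+-comm (F i) _) ⟩
  H i + (sumF (H ∘ punchIn i) + F i)     ≡⟨ sym (+-assoc (H i) _ (F i)) ⟩
  H i + sumF (H ∘ punchIn i) + F i       ≡⟨ cong (_+ F i) (sym (sumF-punchIn H i)) ⟩
  sumF H + F i                          ∎
  where open ≤-Reasoning

_≐_ : VSet n → VSet n → Set
A ≐ B = ∀ v → A v ≡ B v

subsets-complete : ∀ n (R : VSet n) → Any (R ≐_) (subsets n)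
subsets-complete zero R = here (λ ())
subsets-complete (suc n) R = concatMap⁺ _ (Any.map extend (subsets-complete n (R ∘ suc)))
  where
  extend : ∀ {s} → (R ∘ suc) ≐ s → Any (R ≐_) (consB false s ∷ consB true s ∷ [])
  extend R≐s with R zero in R0
  ... | false = here λ { zero → R0 ; (suc i) → R≐s i }
  ... | true = there (here λ { zero → R0 ; (suc i) → R≐s i })

∅ : VSet n
∅ _ = false

⁅_⁆ : Fin n → VSet n
⁅ u ⁆ v = v == u

_∩_ : VSet n → VSet n → VSet n
(A ∩ B) v = A v ∧ B v

_∖_ : VSet n → VSet n → VSet n
(A ∖ B) v = A v ∧ not (B v)

∁ : VSet n → VSet n
∁ A v = not (A v)

Nonempty : VSet n → Set
Nonempty l = Σ _ (λ u → l u ≡ true)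

⊆-trans : {A B C : VSet n} → A ⊆ B → B ⊆ C → A ⊆ C
⊆-trans A⊆B B⊆C v = B⊆C v ∘ A⊆B v

⁅⁆⊆ : {S : VSet n} {u : Fin n} → S u ≡ true → ⁅ u ⁆ ⊆ S
⁅⁆⊆ {S = S} Su v v==u = subst (λ x → S x ≡ true) (sym (==⇒≡ v==u)) Su

_∪⁅_⁆ : VSet n → Fin n → VSet n
I ∪⁅ u ⁆ = I ∪ ⁅ u ⁆

countF-∪⁅⁆ : (I : VSet n) (u : Fin n) → I u ≡ false → countF (I ∪⁅ u ⁆) ≡ suc (countF I)
countF-∪⁅⁆ I u Iu = trans (countF-remove (I ∪⁅ u ⁆) u (∨-introʳ {I u} (==-refl u)))
                          (cong suc (countF-cong drop-u))
  where
  drop-u : ∀ v → (I v ∨ (v == u)) ∧ not (v == u) ≡ I v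
  drop-u v with v == u in v==u
  ... | true = trans (∧-zeroʳ _) (sym (trans (cong I (==⇒≡ v==u)) Iu))
  ... | false = trans (∧-identityʳ _) (∨-identityʳ (I v))

countF-disjoint-∪ : (A B : VSet n) → (∀ v → A v ∧ B v ≡ false) → countF (A ∪ B) ≡ countF A + countF B
countF-disjoint-∪ A B disjoint = sym (begin
  countF A + countF B             ≡⟨ countF-∪-∩ A B ⟩
  countF (A ∪ B) + countF (A ∩ B) ≡⟨ cong (countF (A ∪ B) +_) (countF-zero (A ∩ B) disjoint) ⟩
  countF (A ∪ B) + 0              ≡⟨ +-identityʳ _ ⟩
  countF (A ∪ B)                  ∎)
  where open ≡-Reasoning

-- Linear algebra over GF(2)

Matrix : ℕ → ℕ → Set
Matrix a b = Fin a → Fin b → Bool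

transpose : Matrix a b → Matrix b a
transpose w c u = w u c

lincomb : Matrix a b → VSet a → Fin b → Bool
lincomb w l c = xorF (λ u → l u ∧ w u c)

lincomb-cong : (w : Matrix a b) {l l′ : VSet a} → l ≐ l′ → ∀ c → lincomb w l c ≡ lincomb w l′ c
lincomb-cong w l≐l′ c = xorF-cong (λ u → cong (_∧ w u c) (l≐l′ u))

lincomb-xor : (w : Matrix a b) (l l′ : VSet a) → ∀ c →
  lincomb w (λ u → l u xor l′ u) c ≡ lincomb w l c xor lincomb w l′ c
lincomb-xor w l l′ c =
  trans (xorF-cong (λ u → ∧-distribʳ-xor (w u c) (l u) (l′ u)))
        (xorF-xor (λ u → l u ∧ w u c) (λ u → l′ u ∧ w u c))

lincomb-scaled⁅⁆ : (w : Matrix a b) (β : Bool) (u₀ : Fin a) → ∀ c →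
  lincomb w (λ u → β ∧ (u == u₀)) c ≡ β ∧ w u₀ c
lincomb-scaled⁅⁆ w β u₀ c = trans (xorF-cong rearrange) (xorF-select u₀ (λ u → β ∧ w u c))
  where
  rearrange : ∀ u → (β ∧ (u == u₀)) ∧ w u c ≡ (β ∧ w u c) ∧ (u == u₀)
  rearrange u = trans (∧-assoc β _ _) (trans (cong (β ∧_) (∧-comm (u == u₀) _)) (sym (∧-assoc β _ _)))

lincomb-⁅⁆ : (w : Matrix a b) (u : Fin a) → ∀ c → lincomb w ⁅ u ⁆ c ≡ w u c
lincomb-⁅⁆ w u c = lincomb-scaled⁅⁆ w true u c

lincomb-lincomb : ∀ {a′} (w : Matrix a b) (μ : Matrix a′ a) (l : VSet a′) → ∀ c →
  lincomb w (lincomb μ l) c ≡ xorF (λ r → l r ∧ lincomb w (μ r) c)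
lincomb-lincomb w μ l c =
  trans (xorF-cong (λ u → ∧-xorFʳ (w u c) (λ r → l r ∧ μ r u)))
  (trans (xorF-swap (λ u r → (l r ∧ μ r u) ∧ w u c))
  (xorF-cong (λ r → trans (xorF-cong (λ u → ∧-assoc (l r) (μ r u) (w u c)))
                          (sym (∧-xorFˡ (l r) (λ u → μ r u ∧ w u c))))))

lincomb-zero-column : (w : Matrix a b) {S l : VSet a} (k : Fin b) →
  (∀ u → S u ≡ true → w u k ≡ false) → l ⊆ S → lincomb w l k ≡ false
lincomb-zero-column w {l = l} k zero-on-S l⊆S = xorF-false _ vanish
  where
  vanish : ∀ u → l u ∧ w u k ≡ false
  vanish u with l u in lu
  ... | true = zero-on-S u (l⊆S u lu)
  ... | false = refl

IndependentOn : Matrix a b → VSet b → VSet a → Set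
IndependentOn w K S =
  ∀ l → l ⊆ S → Nonempty l → Σ _ (λ c → K c ≡ true × lincomb w l c ≡ true)

Independent : Matrix a b → VSet a → Set
Independent w S = ∀ l → l ⊆ S → Nonempty l → Σ _ (λ c → lincomb w l c ≡ true)

independent-⊆ : (w : Matrix a b) {R S : VSet a} → R ⊆ S → Independent w S → Independent w R
independent-⊆ w R⊆S ind l l⊆R = ind l (⊆-trans l⊆R R⊆S)

independent-cong : (w : Matrix a b) {R S : VSet a} → R ≐ S → Independent w R → Independent w S
independent-cong w R≐S ind l l⊆S = ind l (λ v lv → trans (R≐S v) (l⊆S v lv))

independent-∅ : (w : Matrix a b) → Independent w ∅
independent-∅ w l l⊆∅ (u , lu) = ⊥-elim (true≢false (l⊆∅ u lu) refl)

independentOn-∅ : (w : Matrix a b) {K : VSet b} {S : VSet a} →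
  (∀ c → K c ≡ false) → IndependentOn w K S → ∀ u → S u ≡ false
independentOn-∅ w K≡∅ ind u = ≢true λ Su →
  let c , Kc , _ = ind ⁅ u ⁆ (⁅⁆⊆ Su) (u , ==-refl u) in true≢false Kc (K≡∅ c)

independentOn-drop-column : (w : Matrix a b) {K : VSet b} {S : VSet a} (k : Fin b) →
  (∀ u → S u ≡ true → w u k ≡ false) →
  IndependentOn w K S → IndependentOn w (K ∖ ⁅ k ⁆) S
independentOn-drop-column w k zero-on-S ind l l⊆S ne =
  let c , Kc , lc = ind l l⊆S ne
  in c , ∧-intro Kc (not-false (≢true (λ c==k →
       true≢false (subst (λ x → lincomb w l x ≡ true) (==⇒≡ c==k) lc)
                  (lincomb-zero-column w k zero-on-S l⊆S)))) , lc

module Pivot (w : Matrix a b) (k : Fin b) (u₀ : Fin a) (pivot : w u₀ k ≡ true) where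

  eliminate : Matrix a b
  eliminate u c = w u c xor (w u k ∧ w u₀ c)

  lift : VSet a → VSet a
  lift l u = l u xor (lincomb w l k ∧ (u == u₀))

  lincomb-eliminate : ∀ l c → lincomb eliminate l c ≡ lincomb w (lift l) c
  lincomb-eliminate l c = begin
    lincomb eliminate l c
      ≡⟨ xorF-cong (λ u → ∧-distribˡ-xor (l u) (w u c) _) ⟩
    xorF (λ u → (l u ∧ w u c) xor (l u ∧ (w u k ∧ w u₀ c)))
      ≡⟨ xorF-xor (λ u → l u ∧ w u c) (λ u → l u ∧ (w u k ∧ w u₀ c)) ⟩
    lincomb w l c xor xorF (λ u → l u ∧ (w u k ∧ w u₀ c))
      ≡⟨ cong (lincomb w l c xor_) (xorF-cong (λ u → sym (∧-assoc (l u) _ _))) ⟩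
    lincomb w l c xor xorF (λ u → (l u ∧ w u k) ∧ w u₀ c)
      ≡⟨ cong (lincomb w l c xor_) (sym (∧-xorFʳ (w u₀ c) (λ u → l u ∧ w u k))) ⟩
    lincomb w l c xor (lincomb w l k ∧ w u₀ c)
      ≡⟨ cong (lincomb w l c xor_) (sym (lincomb-scaled⁅⁆ w _ u₀ c)) ⟩
    lincomb w l c xor lincomb w (λ u → lincomb w l k ∧ (u == u₀)) c
      ≡⟨ sym (lincomb-xor w l _ c) ⟩
    lincomb w (lift l) c ∎
    where open ≡-Reasoning

  lincomb-eliminate-pivot : ∀ l → lincomb eliminate l k ≡ false
  lincomb-eliminate-pivot l = begin
    lincomb eliminate l k                                   ≡⟨ lincomb-eliminate l k ⟩
    lincomb w (lift l) k                                    ≡⟨ lincomb-xor w l _ k ⟩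
    lincomb w l k xor lincomb w (λ u → lincomb w l k ∧ (u == u₀)) k
                                                            ≡⟨ cong (lincomb w l k xor_) (lincomb-scaled⁅⁆ w _ u₀ k) ⟩
    lincomb w l k xor (lincomb w l k ∧ w u₀ k)              ≡⟨ cong (λ x → lincomb w l k xor (lincomb w l k ∧ x)) pivot ⟩
    lincomb w l k xor (lincomb w l k ∧ true)                ≡⟨ cong (lincomb w l k xor_) (∧-identityʳ _) ⟩
    lincomb w l k xor lincomb w l k                         ≡⟨ xor-same (lincomb w l k) ⟩
    false ∎
    where open ≡-Reasoning

  lift-⊆ : {S l : VSet a} → S u₀ ≡ true → l ⊆ (S ∖ ⁅ u₀ ⁆) → lift l ⊆ S
  lift-⊆ {l = l} Su₀ l⊆S′ u lift-u with l u in lu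
  ... | true = ∧-elimˡ (l⊆S′ u lu)
  ... | false = ⁅⁆⊆ Su₀ u (∧-elimʳ {lincomb w l k} lift-u)

  lift-nonempty : {S l : VSet a} → l ⊆ (S ∖ ⁅ u₀ ⁆) → Nonempty l → Nonempty (lift l)
  lift-nonempty {S} {l} l⊆S′ (u , lu) = u , lift-u
    where
    u≢u₀ : (u == u₀) ≡ false
    u≢u₀ = not-true (∧-elimʳ {S u} (l⊆S′ u lu))
    lift-u : lift l u ≡ true
    lift-u rewrite lu | u≢u₀ | ∧-zeroʳ (lincomb w l k) = refl

  independentOn-eliminate : {K : VSet b} {S : VSet a} → S u₀ ≡ true →
    IndependentOn w K S → IndependentOn eliminate (K ∖ ⁅ k ⁆) (S ∖ ⁅ u₀ ⁆)
  independentOn-eliminate Su₀ ind l l⊆S′ ne =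
    let c , Kc , lift-c = ind (lift l) (lift-⊆ Su₀ l⊆S′) (lift-nonempty l⊆S′ ne)
        lc = trans (lincomb-eliminate l c) lift-c
    in c , ∧-intro Kc (not-false (≢true (λ c==k →
         true≢false (subst (λ x → lincomb eliminate l x ≡ true) (==⇒≡ c==k) lc)
                    (lincomb-eliminate-pivot l)))) , lc

independentOn-count≤ : (w : Matrix a b) (K : VSet b) (S : VSet a) →
  IndependentOn w K S → countF S ≤ countF K
independentOn-count≤ w K S = go K (<-wellFounded (countF K)) w S
  where
  go : ∀ {a} (K : VSet b) → Acc _<_ (countF K) → (w : Matrix a b) (S : VSet a) →
    IndependentOn w K S → countF S ≤ countF K
  go K (acc smaller) w S ind with anyF K in K≢∅
  ... | false = ≤-trans (≤-reflexive (countF-zero S (independentOn-∅ w (anyF-false⁻ K K≢∅) ind))) z≤n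
  ... | true with anyF⁻ K K≢∅
  ...   | k , Kk = subst (countF S ≤_) (sym |K|) (by-column-k _ refl)
    where
    K′ : VSet _
    K′ = K ∖ ⁅ k ⁆
    |K| : countF K ≡ suc (countF K′)
    |K| = countF-remove K k Kk
    IH : ∀ {a} (w : Matrix a _) (S : VSet a) → IndependentOn w K′ S → countF S ≤ countF K′
    IH = go K′ (smaller (≤-reflexive (sym |K|)))
    by-column-k : ∀ β → anyF (λ u → S u ∧ w u k) ≡ β → countF S ≤ suc (countF K′)
    by-column-k false column-k = m≤n⇒m≤1+n (IH w S (independentOn-drop-column w k zero-on-S ind))
      where
      zero-on-S : ∀ u → S u ≡ true → w u k ≡ false
      zero-on-S u Su with anyF-false⁻ _ column-k u
      ... | Su∧wuk rewrite Su = Su∧wuk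
    by-column-k true column-k =
      let u₀ , Su₀∧pivot = anyF⁻ _ column-k
          Su₀ = ∧-elimˡ Su₀∧pivot
          pivot = ∧-elimʳ {S u₀} Su₀∧pivot
      in subst (_≤ suc (countF K′)) (sym (countF-remove S u₀ Su₀))
           (s≤s (IH _ (S ∖ ⁅ u₀ ⁆) (Pivot.independentOn-eliminate w k u₀ pivot Su₀ ind)))

foldr-∧-true⁻ : ∀ {A : Set} (t : A → Bool) (xs : List A) →
  foldr (λ x acc → acc ∧ t x) true xs ≡ true → All (λ x → t x ≡ true) xs
foldr-∧-true⁻ t [] _ = []
foldr-∧-true⁻ t (x ∷ xs) e = ∧-elimʳ e ∷ foldr-∧-true⁻ t xs (∧-elimˡ e)

foldr-∧-false⁻ : ∀ {A : Set} (t : A → Bool) (xs : List A) →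
  foldr (λ x acc → acc ∧ t x) true xs ≡ false → Σ A (λ x → t x ≡ false)
foldr-∧-false⁻ t (x ∷ xs) e with foldr (λ x acc → acc ∧ t x) true xs in rest
... | false = foldr-∧-false⁻ t xs rest
... | true = x , e

maxWhere : ∀ {A : Set} → (A → Bool) → (A → ℕ) → List A → ℕ
maxWhere p g = foldr (λ x acc → if p x then g x ⊔ acc else acc) 0

module _ {A : Set} (p : A → Bool) (g : A → ℕ) where

  maxWhere-≥ : ∀ {k} (xs : List A) → Any (λ x → p x ≡ true × k ≤ g x) xs → k ≤ maxWhere p g xs
  maxWhere-≥ (x ∷ xs) (here (px , k≤gx)) rewrite px = ≤-trans k≤gx (m≤m⊔n _ _)
  maxWhere-≥ (x ∷ xs) (there found) with p x
  ... | true = ≤-trans (maxWhere-≥ xs found) (m≤n⊔m _ _)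
  ... | false = maxWhere-≥ xs found

  maxWhere-attained : (xs : List A) →
    maxWhere p g xs ≡ 0 ⊎ Σ A (λ x → p x ≡ true × g x ≡ maxWhere p g xs)
  maxWhere-attained [] = inj₁ refl
  maxWhere-attained (x ∷ xs) with p x in px | maxWhere-attained xs
  ... | false | ih = ih
  ... | true | ih with ⊔-sel (g x) (maxWhere p g xs)
  ...   | inj₁ max≡gx = inj₂ (x , px , sym max≡gx)
  ...   | inj₂ max≡rest = Sum.map (trans max≡rest) (λ (y , py , gy) → y , py , trans gy (sym max≡rest)) ih

-- For square matrices `rank` of Defs is definitionally `rk`.

independentᵇ : Matrix a b → VSet a → Bool
independentᵇ {a} M R =
  foldr (λ R′ acc → acc ∧
           (not (subB R′ R ∧ anyF R′)
            ∨ anyF (λ col → xorF (λ u → R′ u ∧ M u col))))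
        true (subsets a)

rk : Matrix a b → ℕ
rk {a} M = maxWhere (independentᵇ M) countF (subsets a)

module _ (M : Matrix a b) where

  independentᵇ-false⁻ : ∀ R → independentᵇ M R ≡ false →
    Σ (VSet a) (λ l → l ⊆ R × Nonempty l × ∀ c → lincomb M l c ≡ false)
  independentᵇ-false⁻ R e with foldr-∧-false⁻ _ (subsets _) e
  ... | l , fails with subB l R ∧ anyF l in l-ok
  ...   | true =
    l , subB⁻ l R (∧-elimˡ l-ok) , anyF⁻ l (∧-elimʳ {subB l R} l-ok) , anyF-false⁻ _ fails

  independentᵇ-true⁻ : ∀ R → independentᵇ M R ≡ true → Independent M R
  independentᵇ-true⁻ R e l l⊆R (u , lu) =
    let l′-ok , l≐l′ = lookupAny (foldr-∧-true⁻ _ (subsets _) e) (subsets-complete _ l)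
        l′ = Any.lookup (subsets-complete _ l)
        sub = subB⁺ l′ R (λ v l′v → l⊆R v (trans (l≐l′ v) l′v))
        ne = anyF⁺ l′ u (trans (sym (l≐l′ u)) lu)
        c , l′c = anyF⁻ _ (subst (λ x → not x ∨ _ ≡ true) (cong₂ _∧_ sub ne) l′-ok)
    in c , trans (lincomb-cong M l≐l′ c) l′c

  independent⇒independentᵇ : ∀ R → Independent M R → independentᵇ M R ≡ true
  independent⇒independentᵇ R ind with independentᵇ M R in e
  ... | true = refl
  ... | false =
    let l , l⊆R , ne , l≡0 = independentᵇ-false⁻ R e
        c , lc = ind l l⊆R ne
    in ⊥-elim (true≢false lc (l≡0 c))

  count≤rk : ∀ R → Independent M R → countF R ≤ rk M
  count≤rk R ind = maxWhere-≥ (independentᵇ M) countF (subsets a)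
    (Any.map (λ {R′} R≐R′ → independent⇒independentᵇ R′ (independent-cong M R≐R′ ind) ,
                              ≤-reflexive (countF-cong R≐R′))
             (subsets-complete a R))

  basis : Σ (VSet a) (λ R → Independent M R × countF R ≡ rk M)
  basis with maxWhere-attained (independentᵇ M) countF (subsets a)
  ... | inj₁ rk≡0 = ∅ , independent-∅ M , trans (countF-zero {a} ∅ (λ _ → refl)) (sym rk≡0)
  ... | inj₂ (R , indR , |R|) = R , independentᵇ-true⁻ R indR , |R|

rk-mono : (M : Matrix a b) {b′ : ℕ} (M′ : Matrix a b′) →
  (∀ R → Independent M R → Independent M′ R) → rk M ≤ rk M′
rk-mono M M′ preserves =
  let R , indR , |R| = basis M in subst (_≤ rk M′) |R| (count≤rk M′ R (preserves R indR))

rk-cong : (M M′ : Matrix a b) → (∀ u c → M u c ≡ M′ u c) → rk M ≡ rk M′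
rk-cong M M′ M≗M′ = ≤-antisym (rk-mono M M′ (transfer M M′ M≗M′))
                              (rk-mono M′ M (transfer M′ M (λ u c → sym (M≗M′ u c))))
  where
  transfer : (M M′ : Matrix a b) → (∀ u c → M u c ≡ M′ u c) → ∀ R → Independent M R → Independent M′ R
  transfer M M′ M≗M′ R ind l l⊆R ne =
    let c , lc = ind l l⊆R ne in c , trans (sym (xorF-cong (λ u → cong (l u ∧_) (M≗M′ u c)))) lc

InSpan : Matrix a b → VSet a → Fin a → Set
InSpan {a} w I u = Σ (VSet a) (λ μ → μ ⊆ I × ∀ c → w u c ≡ lincomb w μ c)

module _ (w : Matrix a b) where

  member-inSpan : {I : VSet a} (u : Fin a) → I u ≡ true → InSpan w I u
  member-inSpan u Iu = ⁅ u ⁆ , ⁅⁆⊆ Iu , (λ c → sym (lincomb-⁅⁆ w u c))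

  private
    whenTrue : (β : Bool) → (β ≡ true → VSet a) → VSet a
    whenTrue true μ = μ refl
    whenTrue false _ = ∅

    whenTrue-spec : {P : VSet a → Set} (β : Bool) (h : β ≡ true → Σ (VSet a) P) →
      β ≡ true → P (whenTrue β (proj₁ ∘ h))
    whenTrue-spec true h refl = proj₂ (h refl)

  independent-inSpan-count≤ : (I R : VSet a) → Independent w R →
    (∀ r → R r ≡ true → InSpan w I r) → countF R ≤ countF I
  independent-inSpan-count≤ I R ind span = independentOn-count≤ μ I R independentOn-I
    where
    μ : Matrix a a
    μ r = whenTrue (R r) (proj₁ ∘ span r)

    μ⊆I : ∀ r → R r ≡ true → μ r ⊆ I
    μ⊆I r Rr = proj₁ (whenTrue-spec (R r) (span r) Rr)

    row-r : ∀ r → R r ≡ true → ∀ c → w r c ≡ lincomb w (μ r) c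
    row-r r Rr = proj₂ (whenTrue-spec (R r) (span r) Rr)

    expand : ∀ {l} → l ⊆ R → ∀ c r → l r ∧ w r c ≡ l r ∧ lincomb w (μ r) c
    expand {l} l⊆R c r with l r in lr
    ... | true = row-r r (l⊆R r lr) c
    ... | false = refl

    independentOn-I : IndependentOn μ I R
    independentOn-I l l⊆R ne =
      let c , lc = ind l l⊆R ne
          μl-c = trans (lincomb-lincomb w μ l c) (trans (sym (xorF-cong (expand l⊆R c))) lc)
          i , μl-i∧wic = xorF⁻ _ μl-c
          r , lr∧μri = xorF⁻ _ (∧-elimˡ μl-i∧wic)
      in i , μ⊆I r (l⊆R r (∧-elimˡ lr∧μri)) i (∧-elimʳ {l r} lr∧μri) , ∧-elimˡ μl-i∧wic

  dependent-inSpan : {I : VSet a} → Independent w I → (u : Fin a) → I u ≡ false →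
    independentᵇ w (I ∪⁅ u ⁆) ≡ false → InSpan w I u
  dependent-inSpan {I} indI u Iu dep with independentᵇ-false⁻ w (I ∪⁅ u ⁆) dep
  ... | l , l⊆I+u , ne , l≡0 with l u in lu
  ...   | false = ⊥-elim (true≢false (proj₂ (indI l l⊆I ne)) (l≡0 _))
    where
    l⊆I : l ⊆ I
    l⊆I v lv with ∨-elim (l⊆I+u v lv)
    ... | inj₁ Iv = Iv
    ... | inj₂ v==u = ⊥-elim (true≢false (subst (λ x → l x ≡ true) (==⇒≡ v==u) lv) lu)
  ...   | true = μ , μ⊆I , row-u
    where
    μ : VSet a
    μ = l ∖ ⁅ u ⁆
    μ⊆I : μ ⊆ I
    μ⊆I v μv with ∨-elim (l⊆I+u v (∧-elimˡ μv))
    ... | inj₁ Iv = Iv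
    ... | inj₂ v==u = ⊥-elim (true≢false v==u (not-true (∧-elimʳ {l v} μv)))
    split : ∀ v → l v ≡ μ v xor ⁅ u ⁆ v
    split v with v == u in v==u
    ... | true = at-u (trans (cong l (==⇒≡ v==u)) lu)
      where
      at-u : ∀ {x} → x ≡ true → x ≡ (x ∧ false) xor true
      at-u refl = refl
    ... | false = sym (trans (xor-identityʳ _) (∧-identityʳ (l v)))
    row-u : ∀ c → w u c ≡ lincomb w μ c
    row-u c = xor-cancel (begin
      lincomb w μ c xor w u c                  ≡⟨ cong (lincomb w μ c xor_) (sym (lincomb-⁅⁆ w u c)) ⟩
      lincomb w μ c xor lincomb w ⁅ u ⁆ c      ≡⟨ sym (lincomb-xor w μ ⁅ u ⁆ c) ⟩
      lincomb w (λ v → μ v xor ⁅ u ⁆ v) c      ≡⟨ sym (lincomb-cong w split c) ⟩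
      lincomb w l c                            ≡⟨ l≡0 c ⟩
      false                                    ∎)
      where
      open ≡-Reasoning
      xor-cancel : ∀ {x y} → y xor x ≡ false → x ≡ y
      xor-cancel {true} {true} _ = refl
      xor-cancel {false} {false} _ = refl

  basis-spans : (R : VSet a) → Independent w R → countF R ≡ rk w → ∀ u → InSpan w R u
  basis-spans R indR |R| u with R u in Ru
  ... | true = member-inSpan u Ru
  ... | false with independentᵇ w (R ∪⁅ u ⁆) in indR+u
  ...   | false = dependent-inSpan indR u Ru indR+u
  ...   | true = ⊥-elim (<-irrefl refl (begin-strict
    rk w                 ≡⟨ sym |R| ⟩
    countF R             <⟨ n<1+n _ ⟩
    suc (countF R)       ≡⟨ sym (countF-∪⁅⁆ R u Ru) ⟩
    countF (R ∪⁅ u ⁆)    ≤⟨ count≤rk w _ (independentᵇ-true⁻ w _ indR+u) ⟩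
    rk w                 ∎))
    where open ≤-Reasoning

lincomb-transpose-inSpan : (w : Matrix a b) (ν : VSet b) (x : Fin a) (μ : VSet a) →
  (∀ c → w x c ≡ lincomb w μ c) →
  lincomb (transpose w) ν x ≡ xorF (λ r → μ r ∧ lincomb (transpose w) ν r)
lincomb-transpose-inSpan w ν x μ row-x = begin
  lincomb (transpose w) ν x
    ≡⟨ xorF-cong (λ q → cong (ν q ∧_) (row-x q)) ⟩
  xorF (λ q → ν q ∧ xorF (λ r → μ r ∧ w r q))
    ≡⟨ xorF-cong (λ q → ∧-xorFˡ (ν q) (λ r → μ r ∧ w r q)) ⟩
  xorF (λ q → xorF (λ r → ν q ∧ (μ r ∧ w r q)))
    ≡⟨ xorF-swap (λ q r → ν q ∧ (μ r ∧ w r q)) ⟩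
  xorF (λ r → xorF (λ q → ν q ∧ (μ r ∧ w r q)))
    ≡⟨ xorF-cong (λ r → trans (xorF-cong (λ q → ∧-rotate (ν q) (μ r) (w r q)))
                              (sym (∧-xorFˡ (μ r) (λ q → ν q ∧ w r q)))) ⟩
  xorF (λ r → μ r ∧ lincomb (transpose w) ν r) ∎
  where
  open ≡-Reasoning
  ∧-rotate : ∀ x y z → x ∧ (y ∧ z) ≡ y ∧ (x ∧ z)
  ∧-rotate x y z = trans (sym (∧-assoc x y z)) (trans (cong (_∧ z) (∧-comm x y)) (∧-assoc y x z))

-- Every row is a combination of the basis rows R, so a combination of columns
-- that is nonzero on some row is already nonzero on R.
independentᵀ⇒independentOn-basis : (w : Matrix a b) (R : VSet a) → Independent w R → countF R ≡ rk w →
  (Q : VSet b) → Independent (transpose w) Q → IndependentOn (transpose w) R Q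
independentᵀ⇒independentOn-basis w R indR |R| Q indQ ν ν⊆Q ne =
  let x , νx = indQ ν ν⊆Q ne
      μ , μ⊆R , row-x = basis-spans w R indR |R| x
      r , μr∧νr = xorF⁻ _ (trans (sym (lincomb-transpose-inSpan w ν x μ row-x)) νx)
  in r , μ⊆R r (∧-elimˡ μr∧νr) , ∧-elimʳ {μ r} μr∧νr

rk-transpose≤ : (w : Matrix a b) → rk (transpose w) ≤ rk w
rk-transpose≤ w =
  let R , indR , |R| = basis w
      Q , indQ , |Q| = basis (transpose w)
  in begin
    rk (transpose w) ≡⟨ sym |Q| ⟩
    countF Q         ≤⟨ independentOn-count≤ (transpose w) R Q
                          (independentᵀ⇒independentOn-basis w R indR |R| Q indQ) ⟩
    countF R         ≡⟨ |R| ⟩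
    rk w             ∎
  where open ≤-Reasoning

rk-transpose : (w : Matrix a b) → rk (transpose w) ≡ rk w
rk-transpose w = ≤-antisym (rk-transpose≤ w) (rk-transpose≤ (transpose w))

module _ (w : Matrix a b) where

  augment : {I R : VSet a} → Independent w I → Independent w R → countF I < countF R →
    Σ (Fin a) (λ r → I r ≡ false × Independent w (I ∪⁅ r ⁆))
  augment {I} {R} indI indR |I|<|R|
    with anyF (λ r → R r ∧ not (I r) ∧ independentᵇ w (I ∪⁅ r ⁆)) in found
  ... | true =
    let r , ok = anyF⁻ _ found
        rest = ∧-elimʳ {R r} ok
    in r , not-true (∧-elimˡ rest) , independentᵇ-true⁻ w _ (∧-elimʳ {not (I r)} rest)
  ... | false = ⊥-elim (<⇒≱ |I|<|R| (independent-inSpan-count≤ w I R indR spanned))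
    where
    spanned : ∀ r → R r ≡ true → InSpan w I r
    spanned r Rr with I r in Ir | anyF-false⁻ _ found r
    ... | true | _ = member-inSpan w r Ir
    ... | false | no-augmentation rewrite Rr = dependent-inSpan w indI r Ir no-augmentation

  extend-to-basis : {I : VSet a} → Independent w I →
    Σ (VSet a) (λ J → I ⊆ J × Independent w J × countF J ≡ rk w)
  extend-to-basis {I} indI = go (rk w ∸ countF I) indI (m+[n∸m]≡n (count≤rk w I indI))
    where
    go : ∀ gap {I} → Independent w I → countF I + gap ≡ rk w →
      Σ (VSet a) (λ J → I ⊆ J × Independent w J × countF J ≡ rk w)
    go zero {I} indI |I| = I , (λ _ Iv → Iv) , indI , trans (sym (+-identityʳ _)) |I|
    go (suc gap) {I} indI |I|+gap =
      let R , indR , |R| = basis w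
          r , Ir , indI+r = augment indI indR
            (subst (countF I <_) (trans |I|+gap (sym |R|)) (m<m+n (countF I) z<s))
          |I+r|+gap = trans (cong (_+ gap) (countF-∪⁅⁆ I r Ir)) (trans (sym (+-suc _ gap)) |I|+gap)
          J , I+r⊆J , indJ , |J| = go gap indI+r |I+r|+gap
      in J , (λ v Iv → I+r⊆J v (∨-introˡ Iv)) , indJ , |J|

-- Submodularity of rank

restrictRows : VSet a → Matrix a b → Matrix a b
restrictRows X w u c = X u ∧ w u c

module _ (X : VSet a) (w : Matrix a b) where

  lincomb-restrictRows : ∀ {l} → l ⊆ X → ∀ c → lincomb (restrictRows X w) l c ≡ lincomb w l c
  lincomb-restrictRows {l} l⊆X c = xorF-cong inside
    where
    inside : ∀ u → l u ∧ (X u ∧ w u c) ≡ l u ∧ w u c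
    inside u with l u in lu
    ... | true rewrite l⊆X u lu = refl
    ... | false = refl

  independent-restrictRows⁻ : ∀ {S} → Independent (restrictRows X w) S → S ⊆ X × Independent w S
  independent-restrictRows⁻ {S} ind = S⊆X , λ l l⊆S ne →
    let c , lc = ind l l⊆S ne in c , trans (sym (lincomb-restrictRows (⊆-trans l⊆S S⊆X) c)) lc
    where
    S⊆X : S ⊆ X
    S⊆X u Su = let c , uc = ind ⁅ u ⁆ (⁅⁆⊆ Su) (u , ==-refl u)
               in ∧-elimˡ (trans (sym (lincomb-⁅⁆ (restrictRows X w) u c)) uc)

  independent-restrictRows⁺ : ∀ {S} → S ⊆ X → Independent w S → Independent (restrictRows X w) S
  independent-restrictRows⁺ S⊆X ind l l⊆S ne =
    let c , lc = ind l l⊆S ne in c , trans (lincomb-restrictRows (⊆-trans l⊆S S⊆X) c) lc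

-- Extend a basis of the rows in A ∩ B to one of the rows in A ∪ B.
rk-restrictRows-submodular : (w : Matrix a b) (A B : VSet a) →
  rk (restrictRows (A ∪ B) w) + rk (restrictRows (A ∩ B) w) ≤ rk (restrictRows A w) + rk (restrictRows B w)
rk-restrictRows-submodular w A B =
  let I , indI , |I| = basis (restrictRows (A ∩ B) w)
      I⊆A∩B , indI′ = independent-restrictRows⁻ (A ∩ B) w indI
      I⊆A∪B : I ⊆ (A ∪ B)
      I⊆A∪B v Iv = ∨-introˡ {A v} (∧-elimˡ {A v} (I⊆A∩B v Iv))
      J , I⊆J , indJ , |J| = extend-to-basis (restrictRows (A ∪ B) w)
                                (independent-restrictRows⁺ (A ∪ B) w I⊆A∪B indI′)
      J⊆A∪B , indJ′ = independent-restrictRows⁻ (A ∪ B) w indJ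
  in begin
    rk (restrictRows (A ∪ B) w) + rk (restrictRows (A ∩ B) w)
      ≡⟨ cong₂ _+_ (sym |J|) (sym |I|) ⟩
    countF J + countF I
      ≤⟨ +-monoʳ-≤ (countF J) (countF-mono I (J ∩ (A ∩ B)) (λ v Iv → ∧-intro (I⊆J v Iv) (I⊆A∩B v Iv))) ⟩
    countF J + countF (J ∩ (A ∩ B))
      ≡⟨ cong₂ _+_ (countF-cong (λ v → sym (J-split J⊆A∪B v))) (countF-cong (λ v → J-meet (J v) (A v) (B v))) ⟩
    countF (λ v → (J v ∧ A v) ∨ (J v ∧ B v)) + countF (λ v → (J v ∧ A v) ∧ (J v ∧ B v))
      ≡⟨ sym (countF-∪-∩ (J ∩ A) (J ∩ B)) ⟩
    countF (J ∩ A) + countF (J ∩ B)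
      ≤⟨ +-mono-≤ (J∩-count≤rk A indJ′) (J∩-count≤rk B indJ′) ⟩
    rk (restrictRows A w) + rk (restrictRows B w) ∎
  where
  open ≤-Reasoning
  J∩-count≤rk : ∀ {J} X → Independent w J → countF (J ∩ X) ≤ rk (restrictRows X w)
  J∩-count≤rk {J} X indJ = count≤rk (restrictRows X w) (J ∩ X)
    (independent-restrictRows⁺ X w (λ v → ∧-elimʳ {J v}) (independent-⊆ w (λ v → ∧-elimˡ) indJ))
  J-split : ∀ {J} → J ⊆ (A ∪ B) → ∀ v → (J v ∧ A v) ∨ (J v ∧ B v) ≡ J v
  J-split {J} J⊆A∪B v with J v in Jv
  ... | true = J⊆A∪B v Jv
  ... | false = refl
  J-meet : ∀ x y z → x ∧ (y ∧ z) ≡ (x ∧ y) ∧ (x ∧ z)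
  J-meet true y z = refl
  J-meet false y z = refl

lincomb-++ : (F : Matrix a b) (G : Matrix a b′) (l : VSet a) (c : Fin (b + b′)) →
  lincomb (λ u → F u ++ G u) l c ≡ [ lincomb F l , lincomb G l ] (splitAt b c)
lincomb-++ F G l c = on-block (splitAt _ c)
  where
  on-block : ∀ s → xorF (λ u → l u ∧ [ F u , G u ] s) ≡ [ lincomb F l , lincomb G l ] s
  on-block (inj₁ x) = refl
  on-block (inj₂ y) = refl

++-pointwise : (op : Bool → Bool → Bool) (f f′ : VSet a) (g g′ : VSet b) (i : Fin (a + b)) →
  op ((f ++ g) i) ((f′ ++ g′) i) ≡ ((λ x → op (f x) (f′ x)) ++ (λ y → op (g y) (g′ y))) i
++-pointwise op f f′ g g′ i = on-block (splitAt _ i)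
  where
  on-block : ∀ s → op ([ f , g ] s) ([ f′ , g′ ] s) ≡ [ (λ x → op (f x) (f′ x)) , (λ y → op (g y) (g′ y)) ] s
  on-block (inj₁ x) = refl
  on-block (inj₂ y) = refl

++-cong : {f f′ : VSet a} {g g′ : VSet b} → f ≐ f′ → g ≐ g′ → (f ++ g) ≐ (f′ ++ g′)
++-cong {a} f≐f′ g≐g′ i with splitAt a i
... | inj₁ x = f≐f′ x
... | inj₂ y = g≐g′ y

↑-view : (c : Fin (a + b)) → Σ (Fin a) (λ x → x ↑ˡ b ≡ c) ⊎ Σ (Fin b) (λ y → a ↑ʳ y ≡ c)
↑-view {a} c with splitAt a c in eq
... | inj₁ x = inj₁ (x , splitAt⁻¹-↑ˡ eq)
... | inj₂ y = inj₂ (y , splitAt⁻¹-↑ʳ eq)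

mask : VSet a → VSet b → Matrix a b → Matrix a b
mask X Y M u c = X u ∧ (Y c ∧ M u c)

-- Bordering the rows Z of M by an identity block makes them independent of
-- everything else, so they add exactly |Z| to the rank.
module Bordered (M : Matrix a b) (Z : VSet a) (Y : VSet b) where

  MY : Matrix a b
  MY u c = Y c ∧ M u c

  N : Matrix a (a + b)
  N z = (λ x → Z x ∧ (z == x)) ++ MY z

  lincomb-N-left : ∀ l x → lincomb N l (x ↑ˡ b) ≡ Z x ∧ l x
  lincomb-N-left l x = begin
    lincomb N l (x ↑ˡ b)
      ≡⟨ lincomb-++ (λ z x → Z x ∧ (z == x)) MY l (x ↑ˡ b) ⟩
    [ lincomb (λ z x → Z x ∧ (z == x)) l , lincomb MY l ] (splitAt a (x ↑ˡ b))
      ≡⟨ cong [ lincomb (λ z x → Z x ∧ (z == x)) l , lincomb MY l ] (splitAt-↑ˡ a x b) ⟩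
    xorF (λ u → l u ∧ (Z x ∧ (u == x)))
      ≡⟨ xorF-cong (λ u → trans (sym (∧-assoc (l u) (Z x) _)) (cong (_∧ (u == x)) (∧-comm (l u) (Z x)))) ⟩
    xorF (λ u → (Z x ∧ l u) ∧ (u == x))
      ≡⟨ xorF-select x (λ u → Z x ∧ l u) ⟩
    Z x ∧ l x ∎
    where open ≡-Reasoning

  lincomb-N-right : ∀ l y → lincomb N l (a ↑ʳ y) ≡ lincomb MY l y
  lincomb-N-right l y =
    trans (lincomb-++ (λ z x → Z x ∧ (z == x)) MY l (a ↑ʳ y))
          (cong [ lincomb (λ z x → Z x ∧ (z == x)) l , lincomb MY l ] (splitAt-↑ʳ a b y))

  private
    Z∪R-independent : ∀ {R} → R ⊆ ∁ Z → Independent MY R → Independent N (Z ∪ R)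
    Z∪R-independent {R} R⊆∁Z indR l l⊆Z∪R ne with anyF (λ u → l u ∧ Z u) in meets-Z
    ... | true = let z , lz∧Zz = anyF⁻ _ meets-Z
                 in z ↑ˡ b , trans (lincomb-N-left l z) (∧-intro (∧-elimʳ {l z} lz∧Zz) (∧-elimˡ lz∧Zz))
    ... | false = let y , ly = indR l l⊆R ne in a ↑ʳ y , trans (lincomb-N-right l y) ly
      where
      l⊆R : l ⊆ R
      l⊆R u lu with ∨-elim (l⊆Z∪R u lu)
      ... | inj₁ Zu = ⊥-elim (true≢false (∧-intro lu Zu) (anyF-false⁻ _ meets-Z u))
      ... | inj₂ Ru = Ru

    outside-Z-independent : ∀ {R} → Independent N R → Independent MY (R ∖ Z)
    outside-Z-independent {R} indR l l⊆R∖Z ne with indR l (λ u lu → ∧-elimˡ (l⊆R∖Z u lu)) ne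
    ... | c , lc with ↑-view {a} {b} c
    ...   | inj₁ (x , refl) = ⊥-elim (true≢false (trans (sym (lincomb-N-left l x)) lc) off-Z)
      where
      off-Z : Z x ∧ l x ≡ false
      off-Z with l x in lx
      ... | true = trans (∧-identityʳ (Z x)) (not-true (∧-elimʳ {R x} (l⊆R∖Z x lx)))
      ... | false = ∧-zeroʳ (Z x)
    ...   | inj₂ (y , refl) = y , trans (sym (lincomb-N-right l y)) lc

  rk-N : rk N ≡ countF Z + rk (mask (∁ Z) Y M)
  rk-N = ≤-antisym upper lower
    where
    open ≤-Reasoning
    upper : rk N ≤ countF Z + rk (mask (∁ Z) Y M)
    upper = let R , indR , |R| = basis N in begin
      rk N                                ≡⟨ sym |R| ⟩
      countF R                            ≡⟨ countF-cong (λ u → sym (split-by-Z (R u) (Z u))) ⟩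
      countF ((R ∩ Z) ∪ (R ∖ Z))          ≡⟨ countF-disjoint-∪ (R ∩ Z) (R ∖ Z) (λ u → disjoint (R u) (Z u)) ⟩
      countF (R ∩ Z) + countF (R ∖ Z)
        ≤⟨ +-mono-≤ (countF-mono (R ∩ Z) Z (λ u → ∧-elimʳ {R u}))
                    (count≤rk (mask (∁ Z) Y M) (R ∖ Z)
                       (independent-restrictRows⁺ (∁ Z) MY (λ u → ∧-elimʳ {R u}) (outside-Z-independent indR))) ⟩
      countF Z + rk (mask (∁ Z) Y M)      ∎
      where
      split-by-Z : ∀ r z → (r ∧ z) ∨ (r ∧ not z) ≡ r
      split-by-Z true true = refl
      split-by-Z true false = refl
      split-by-Z false z = refl
      disjoint : ∀ r z → (r ∧ z) ∧ (r ∧ not z) ≡ false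
      disjoint true true = refl
      disjoint true false = refl
      disjoint false z = refl
    lower : countF Z + rk (mask (∁ Z) Y M) ≤ rk N
    lower = let R , indR , |R| = basis (mask (∁ Z) Y M)
                R⊆∁Z , indR′ = independent-restrictRows⁻ (∁ Z) MY indR
            in begin
      countF Z + rk (mask (∁ Z) Y M)  ≡⟨ cong (countF Z +_) (sym |R|) ⟩
      countF Z + countF R             ≡⟨ sym (countF-disjoint-∪ Z R (λ u → disjoint {R} (R⊆∁Z u))) ⟩
      countF (Z ∪ R)                  ≤⟨ count≤rk N (Z ∪ R) (Z∪R-independent R⊆∁Z indR′) ⟩
      rk N                            ∎
      where
      disjoint : ∀ {R : VSet a} {u} → (R u ≡ true → not (Z u) ≡ true) → Z u ∧ R u ≡ false
      disjoint {R} {u} R⊆∁Z with R u in Ru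
      ... | true = trans (∧-identityʳ (Z u)) (not-true (R⊆∁Z refl))
      ... | false = ∧-zeroʳ (Z u)

-- The unit vectors of Fin a followed by the columns of M.  Its rows ∁ X ++ Y
-- have rank |∁ X| + rank M[X, Y], so submodularity of the rank of a set of
-- rows becomes submodularity of (X , Y) ↦ rank M[X, Y].
module _ (M : Matrix a b) where

  stacked : Matrix (a + b) a
  stacked c z = ((z ==_) ++ M z) c

  rk-restrictRows-cong : ∀ {c} {w : Matrix c a} {T T′ : VSet c} → T ≐ T′ →
    rk (restrictRows T w) ≡ rk (restrictRows T′ w)
  rk-restrictRows-cong {w = w} T≐T′ = rk-cong _ _ (λ u z → cong (_∧ w u z) (T≐T′ u))

  rk-stacked-rows : ∀ X Y → rk (restrictRows (∁ X ++ Y) stacked) ≡ countF (∁ X) + rk (mask X Y M)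
  rk-stacked-rows X Y = begin
    rk (restrictRows (∁ X ++ Y) stacked)
      ≡⟨ sym (rk-transpose (restrictRows (∁ X ++ Y) stacked)) ⟩
    rk (transpose (restrictRows (∁ X ++ Y) stacked))
      ≡⟨ rk-cong _ _ (λ z c → ++-pointwise _∧_ (∁ X) (z ==_) Y (M z) c) ⟩
    rk (Bordered.N M (∁ X) Y)
      ≡⟨ Bordered.rk-N M (∁ X) Y ⟩
    countF (∁ X) + rk (mask (∁ (∁ X)) Y M)
      ≡⟨ cong (countF (∁ X) +_) (rk-cong _ _ (λ u c → cong (_∧ (Y c ∧ M u c)) (not-involutive (X u)))) ⟩
    countF (∁ X) + rk (mask X Y M) ∎
    where open ≡-Reasoning

  rk-mask-submodular : ∀ X₁ Y₁ X₂ Y₂ →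
    rk (mask (X₁ ∩ X₂) (Y₁ ∪ Y₂) M) + rk (mask (X₁ ∪ X₂) (Y₁ ∩ Y₂) M)
      ≤ rk (mask X₁ Y₁ M) + rk (mask X₂ Y₂ M)
  rk-mask-submodular X₁ Y₁ X₂ Y₂ = +-cancelˡ-≤ K _ _ (begin
    K + (ρ (X₁ ∩ X₂) (Y₁ ∪ Y₂) + ρ (X₁ ∪ X₂) (Y₁ ∩ Y₂))
      ≡⟨ +-interchange (countF (∁ (X₁ ∩ X₂))) _ _ _ ⟩
    (countF (∁ (X₁ ∩ X₂)) + ρ (X₁ ∩ X₂) (Y₁ ∪ Y₂))
      + (countF (∁ (X₁ ∪ X₂)) + ρ (X₁ ∪ X₂) (Y₁ ∩ Y₂))
      ≡⟨ sym (cong₂ _+_ (trans (rk-restrictRows-cong T₁∪T₂) (rk-stacked-rows (X₁ ∩ X₂) (Y₁ ∪ Y₂)))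
                        (trans (rk-restrictRows-cong T₁∩T₂) (rk-stacked-rows (X₁ ∪ X₂) (Y₁ ∩ Y₂)))) ⟩
    rk (restrictRows (T₁ ∪ T₂) stacked) + rk (restrictRows (T₁ ∩ T₂) stacked)
      ≤⟨ rk-restrictRows-submodular stacked T₁ T₂ ⟩
    rk (restrictRows T₁ stacked) + rk (restrictRows T₂ stacked)
      ≡⟨ cong₂ _+_ (rk-stacked-rows X₁ Y₁) (rk-stacked-rows X₂ Y₂) ⟩
    (countF (∁ X₁) + ρ X₁ Y₁) + (countF (∁ X₂) + ρ X₂ Y₂)
      ≡⟨ +-interchange (countF (∁ X₁)) _ _ _ ⟩
    (countF (∁ X₁) + countF (∁ X₂)) + (ρ X₁ Y₁ + ρ X₂ Y₂)
      ≡⟨ cong (_+ (ρ X₁ Y₁ + ρ X₂ Y₂)) complements ⟩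
    K + (ρ X₁ Y₁ + ρ X₂ Y₂) ∎)
    where
    open ≤-Reasoning
    ρ : VSet a → VSet b → ℕ
    ρ X Y = rk (mask X Y M)
    T₁ T₂ : VSet (a + b)
    T₁ = ∁ X₁ ++ Y₁
    T₂ = ∁ X₂ ++ Y₂
    K : ℕ
    K = countF (∁ (X₁ ∩ X₂)) + countF (∁ (X₁ ∪ X₂))
    T₁∪T₂ : (T₁ ∪ T₂) ≐ (∁ (X₁ ∩ X₂) ++ (Y₁ ∪ Y₂))
    T₁∪T₂ i = trans (++-pointwise _∨_ (∁ X₁) (∁ X₂) Y₁ Y₂ i)
                    (++-cong (λ x → sym (deMorgan₁ (X₁ x) (X₂ x))) (λ _ → refl) i)
    T₁∩T₂ : (T₁ ∩ T₂) ≐ (∁ (X₁ ∪ X₂) ++ (Y₁ ∩ Y₂))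
    T₁∩T₂ i = trans (++-pointwise _∧_ (∁ X₁) (∁ X₂) Y₁ Y₂ i)
                    (++-cong (λ x → sym (deMorgan₂ (X₁ x) (X₂ x))) (λ _ → refl) i)
    complements : countF (∁ X₁) + countF (∁ X₂) ≡ K
    complements = trans (countF-∪-∩ (∁ X₁) (∁ X₂))
      (cong₂ _+_ (countF-cong (λ x → sym (deMorgan₁ (X₁ x) (X₂ x))))
                 (countF-cong (λ x → sym (deMorgan₂ (X₁ x) (X₂ x)))))

-- By definition cutrkA E A is rk (mask A (∁ A) E).
module _ (E : Adj n) where

  cutrkA-cong : ∀ {A B} → A ≐ B → cutrkA E A ≡ cutrkA E B
  cutrkA-cong A≐B = rk-cong _ _ (λ u v → cong₂ (λ x y → x ∧ not y ∧ E u v) (A≐B u) (A≐B v))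

  cutrkA-submodular : ∀ A B → cutrkA E (A ∩ B) + cutrkA E (A ∪ B) ≤ cutrkA E A + cutrkA E B
  cutrkA-submodular A B = subst (_≤ cutrkA E A + cutrkA E B)
    (cong₂ _+_ (rk-cong _ _ (λ u v → cong (λ y → (A u ∧ B u) ∧ (y ∧ E u v)) (sym (deMorgan₁ (A v) (B v)))))
               (rk-cong _ _ (λ u v → cong (λ y → (A u ∨ B u) ∧ (y ∧ E u v)) (sym (deMorgan₂ (A v) (B v))))))
    (rk-mask-submodular E A (∁ A) B (∁ B))

  cutrkA-∁ : (∀ u v → E u v ≡ E v u) → ∀ A → cutrkA E A ≡ cutrkA E (∁ A)
  cutrkA-∁ E-sym A = trans (sym (rk-transpose (mask A (∁ A) E))) (rk-cong _ _ swap)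
    where
    swap : ∀ v u → A u ∧ (not (A v) ∧ E u v) ≡ not (A v) ∧ (not (not (A u)) ∧ E v u)
    swap v u rewrite not-involutive (A u) | E-sym u v =
      trans (sym (∧-assoc (A u) _ _))
            (trans (cong (_∧ E v u) (∧-comm (A u) (not (A v)))) (∧-assoc (not (A v)) (A u) (E v u)))

module _ {V : Set} where

  Child⇒Desc-parent : ∀ {t : BT V} {x y b : Pos t} → Desc x y → Child x b → x ≡ y ⊎ Desc b y
  Child⇒Desc-parent dHere _ = inj₂ dHere
  Child⇒Desc-parent (dL dHere) cL = inj₁ refl
  Child⇒Desc-parent (dL d) (inL c) with Child⇒Desc-parent d c
  ... | inj₁ refl = inj₁ refl
  ... | inj₂ d′ = inj₂ (dL d′)
  Child⇒Desc-parent (dR dHere) cR = inj₁ refl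
  Child⇒Desc-parent (dR d) (inR c) with Child⇒Desc-parent d c
  ... | inj₁ refl = inj₁ refl
  ... | inj₂ d′ = inj₂ (dR d′)

  ParentClosed : {t : BT V} → (Pos t → Bool) → Set
  ParentClosed Q = ∀ {c p} → Child c p → Q c ≡ true → Q p ≡ true

  parentClosed-root : ∀ {t : BT V} (Q : Pos t → Bool) → ParentClosed Q → ∀ b → Q b ≡ true → Q here ≡ true
  parentClosed-root Q closed here Qb = Qb
  parentClosed-root {nd l r} Q closed (goL b) Qb =
    closed cL (parentClosed-root (Q ∘ goL) (closed ∘ inL) b Qb)
  parentClosed-root {nd l r} Q closed (goR b) Qb =
    closed cR (parentClosed-root (Q ∘ goR) (closed ∘ inR) b Qb)

  parentClosed-ancestor : ∀ {t : BT V} (Q : Pos t → Bool) → ParentClosed Q →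
    ∀ {b q} → Desc b q → Q b ≡ true → Q q ≡ true
  parentClosed-ancestor Q closed {b} dHere = parentClosed-root Q closed b
  parentClosed-ancestor Q closed (dL d) = parentClosed-ancestor (Q ∘ goL) (closed ∘ inL) d
  parentClosed-ancestor Q closed (dR d) = parentClosed-ancestor (Q ∘ goR) (closed ∘ inR) d

  allPos-complete : (t : BT V) (p : Pos t) → p ∈ allPos t
  allPos-complete (lf v) here = here refl
  allPos-complete (nd l r) here = here refl
  allPos-complete (nd l r) (goL p) = there (∈-++⁺ˡ (∈-map⁺ goL (allPos-complete l p)))
  allPos-complete (nd l r) (goR p) = there (∈-++⁺ʳ (map goL (allPos l)) (∈-map⁺ goR (allPos-complete r p)))

occ-sub : ∀ {t : BT (Fin n)} (p : Pos t) v → occ v (sub p) ≡ true → occ v t ≡ true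
occ-sub here v occurs = occurs
occ-sub {t = nd l r} (goL p) v occurs = ∨-introˡ (occ-sub p v occurs)
occ-sub {t = nd l r} (goR p) v occurs = ∨-introʳ {occ v l} (occ-sub p v occurs)

occ-Desc : ∀ {t : BT (Fin n)} {p q : Pos t} → Desc p q → ∀ v → occ v (sub p) ≡ true → occ v (sub q) ≡ true
occ-Desc {p = p} dHere = occ-sub p
occ-Desc (dL d) = occ-Desc d
occ-Desc (dR d) = occ-Desc d

occ⇒1≤count : ∀ (t : BT (Fin n)) v → occ v t ≡ true → 1 ≤ count v t
occ⇒1≤count (lf w) v occurs rewrite occurs = ≤-refl
occ⇒1≤count (nd l r) v occurs with ∨-elim occurs
... | inj₁ in-l = ≤-trans (occ⇒1≤count l v in-l) (m≤m+n _ _)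
... | inj₂ in-r = ≤-trans (occ⇒1≤count r v in-r) (m≤n+m _ _)

count-absent : ∀ (t : BT (Fin n)) x → occ x t ≡ false → count x t ≡ 0
count-absent (lf y) x absent rewrite absent = refl
count-absent (nd l r) x absent =
  cong₂ _+_ (count-absent l x (∨-falseˡ absent)) (count-absent r x (∨-falseʳ {occ x l} absent))

count≡1⇒occ : ∀ (t : BT (Fin n)) x → count x t ≡ 1 → occ x t ≡ true
count≡1⇒occ t x once with occ x t in occurs
... | true = refl
... | false with () ← trans (sym once) (count-absent t x occurs)

occ-nested : ∀ {t : BT (Fin n)} (p q : Pos t) v → count v t ≤ 1 →
  occ v (sub p) ≡ true → occ v (sub q) ≡ true → Desc p q ⊎ Desc q p
occ-nested p here v _ _ _ = inj₁ dHere
occ-nested here q v _ _ _ = inj₂ dHere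
occ-nested {t = nd l r} (goL p) (goL q) v once in-p in-q
  with occ-nested p q v (≤-trans (m≤m+n _ _) once) in-p in-q
... | inj₁ d = inj₁ (dL d)
... | inj₂ d = inj₂ (dL d)
occ-nested {t = nd l r} (goR p) (goR q) v once in-p in-q
  with occ-nested p q v (≤-trans (m≤n+m _ _) once) in-p in-q
... | inj₁ d = inj₁ (dR d)
... | inj₂ d = inj₂ (dR d)
occ-nested {t = nd l r} (goL p) (goR q) v once in-p in-q = ⊥-elim (<-irrefl refl
  (≤-trans (+-mono-≤ (occ⇒1≤count l v (occ-sub p v in-p)) (occ⇒1≤count r v (occ-sub q v in-q))) once))
occ-nested {t = nd l r} (goR p) (goL q) v once in-p in-q = ⊥-elim (<-irrefl refl
  (≤-trans (+-mono-≤ (occ⇒1≤count l v (occ-sub q v in-q)) (occ⇒1≤count r v (occ-sub p v in-p))) once))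

module _ {𝒯 : RootedDecomp n} (Tp : LeaflessPrefix 𝒯) where

  Lv-Desc : {p q : Pos (T 𝒯)} → Desc p q → Lv 𝒯 p ⊆ Lv 𝒯 q
  Lv-Desc = occ-Desc

  -- an appendix is a child of a prefix node, so no appendix lies below another
  appendix-antichain : ∀ {x y} → Appendix Tp x → Appendix Tp y → Desc x y → x ≡ y
  appendix-antichain (x∉P , b , inj₂ b-child , b∈P) _ _ =
    ⊥-elim (true≢false (parentClosed Tp b-child b∈P) x∉P)
  appendix-antichain (_ , b , inj₁ x-child , b∈P) (y∉P , _) x-below-y
    with Child⇒Desc-parent x-below-y x-child
  ... | inj₁ x≡y = x≡y
  ... | inj₂ b-below-y = ⊥-elim (true≢false (parentClosed-ancestor (P Tp) (parentClosed Tp) b-below-y b∈P) y∉P)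

  appendix-overlap : ∀ {x y} → Appendix Tp x → Appendix Tp y →
    ∀ v → Lv 𝒯 x v ≡ true → Lv 𝒯 y v ≡ true → x ≡ y
  appendix-overlap {x} {y} app-x app-y v in-x in-y
    with occ-nested x y v (≤-reflexive (bij 𝒯 v)) in-x in-y
  ... | inj₁ x-below-y = appendix-antichain app-x app-y x-below-y
  ... | inj₂ y-below-x = sym (appendix-antichain app-y app-x y-below-x)

Minimiser : (VSet n → ℕ) → (VSet n → Bool) → VSet n → Set
Minimiser f admissible S = admissible S ≡ true × ∀ X → admissible X ≡ true → f S ≤ f X

minimiser : (f : VSet n → ℕ) (admissible : VSet n → Bool) →
  (∀ {X Y} → X ≐ Y → f X ≡ f Y) → (∀ {X Y} → X ≐ Y → admissible X ≡ admissible Y) →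
  ∀ S₀ → admissible S₀ ≡ true → Σ (VSet n) (Minimiser f admissible)
minimiser {n} f admissible f-cong admissible-cong S₀ S₀-ok = S , S-ok , S-min
  where
  candidates : List (VSet n)
  candidates = filter (λ X → admissible X Bool.≟ true) (subsets n)
  S : VSet n
  S = argmin f S₀ candidates
  S-ok : admissible S ≡ true
  S-ok = argmin-all f {P = λ X → admissible X ≡ true} S₀-ok (all-filter _ (subsets n))
  S-min : ∀ X → admissible X ≡ true → f S ≤ f X
  S-min X X-ok =
    let Y , Y∈subsets , X≐Y = find (subsets-complete n X)
        Y∈candidates = ∈-filter⁺ (λ X → admissible X Bool.≟ true) Y∈subsets
                         (trans (sym (admissible-cong X≐Y)) X-ok)
    in ≤-trans (lookup (f[argmin]≤f[xs] {f = f} S₀ candidates) Y∈candidates) (≤-reflexive (sym (f-cong X≐Y)))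

MinimiserBetween : (VSet n → ℕ) → VSet n → VSet n → VSet n → Set
MinimiserBetween f C L S = C ⊆ S × S ⊆ L × (∀ X → C ⊆ X → X ⊆ L → f S ≤ f X)

minimiser-between : (f : VSet n → ℕ) → (∀ {X Y} → X ≐ Y → f X ≡ f Y) →
  ∀ {C L S₀} → C ⊆ S₀ → S₀ ⊆ L → Σ (VSet n) (MinimiserBetween f C L)
minimiser-between f f-cong {C} {L} {S₀} C⊆S₀ S₀⊆L =
  let S , S-ok , S-min = minimiser f between f-cong between-cong S₀ (between⁺ C⊆S₀ S₀⊆L)
  in S , subB⁻ C S (∧-elimˡ S-ok) , subB⁻ S L (∧-elimʳ {subB C S} S-ok) ,
     λ X C⊆X X⊆L → S-min X (between⁺ C⊆X X⊆L)
  where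
  between : VSet _ → Bool
  between X = subB C X ∧ subB X L
  between⁺ : ∀ {X} → C ⊆ X → X ⊆ L → between X ≡ true
  between⁺ C⊆X X⊆L = ∧-intro (subB⁺ C _ C⊆X) (subB⁺ _ L X⊆L)
  between-cong : ∀ {X Y} → X ≐ Y → between X ≡ between Y
  between-cong X≐Y = cong₂ _∧_ (allF-cong (λ v → cong (not (C v) ∨_) (X≐Y v)))
                               (allF-cong (λ v → cong (λ x → not x ∨ L v) (X≐Y v)))

node? : ∀ {A : Set} → Maybe (BT A) → Maybe (BT A) → Maybe (BT A)
node? nothing r = r
node? (just l) nothing = just l
node? (just l) (just r) = just (nd l r)

module Prune {m : ℕ} (i : Fin (suc m)) where

  prune : BT (Fin (suc m)) → Maybe (BT (Fin m))
  prune (lf x) with i ≟ x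
  ... | yes _ = nothing
  ... | no i≢x = just (lf (punchOut i≢x))
  prune (nd l r) = node? (prune l) (prune r)

  prune-nothing : ∀ D → prune D ≡ nothing → ∀ x → occ x D ≡ true → x ≡ i
  prune-nothing (lf y) e x x==y with i ≟ y
  ... | yes refl = ==⇒≡ x==y
  prune-nothing (nd l r) e x occurs with prune l in pl | prune r in pr
  ... | nothing | nothing with ∨-elim {occ x l} occurs
  ...   | inj₁ in-l = prune-nothing l pl x in-l
  ...   | inj₂ in-r = prune-nothing r pr x in-r
  prune-nothing (nd l r) () x occurs | nothing | just _
  prune-nothing (nd l r) () x occurs | just _ | nothing
  prune-nothing (nd l r) () x occurs | just _ | just _

  punchIn-absent : ∀ D → prune D ≡ nothing → ∀ j → occ (punchIn i j) D ≡ false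
  punchIn-absent D e j = ≢true (λ occurs → punchInᵢ≢i i j (prune-nothing D e _ occurs))

  ==-punchOut : ∀ {x} (i≢x : i ≢ x) j → (j == punchOut i≢x) ≡ (punchIn i j == x)
  ==-punchOut i≢x j = does-⇔
    (mk⇔ (λ { refl → punchIn-punchOut i≢x })
         (λ pj≡x → punchIn-injective i _ _ (trans pj≡x (sym (punchIn-punchOut i≢x)))))
    (j ≟ _) (punchIn i j ≟ _)

  record Pruned (D : BT (Fin (suc m))) (D′ : BT (Fin m)) : Set where
    field
      count-pruned : ∀ j → count j D′ ≡ count (punchIn i j) D
      occ-pruned : ∀ j → occ j D′ ≡ occ (punchIn i j) D
      node-pruned : ∀ (q′ : Pos D′) → Σ (Pos D) (λ q → ∀ j → occ j (sub q′) ≡ occ (punchIn i j) (sub q))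
  open Pruned

  prune-just : ∀ D {D′} → prune D ≡ just D′ → Pruned D D′
  prune-just (lf y) e with i ≟ y
  prune-just (lf y) refl | no i≢y = record
    { count-pruned = λ j → cong (if_then 1 else 0) (==-punchOut i≢y j)
    ; occ-pruned = ==-punchOut i≢y
    ; node-pruned = λ { here → here , ==-punchOut i≢y } }
  prune-just (nd l r) e with prune l in pl | prune r in pr
  prune-just (nd l r) refl | just l′ | nothing = record
    { count-pruned = λ j → trans (count-pruned L j)
        (sym (trans (cong (count (punchIn i j) l +_) (count-absent r _ (punchIn-absent r pr j))) (+-identityʳ _)))
    ; occ-pruned = λ j → trans (occ-pruned L j)
        (sym (trans (cong (occ (punchIn i j) l ∨_) (punchIn-absent r pr j)) (∨-identityʳ _)))
    ; node-pruned = λ q′ → let q , same = node-pruned L q′ in goL q , same }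
    where
    L : Pruned l l′
    L = prune-just l pl
  prune-just (nd l r) refl | nothing | just r′ = record
    { count-pruned = λ j → trans (count-pruned R j)
        (sym (cong (_+ count (punchIn i j) r) (count-absent l _ (punchIn-absent l pl j))))
    ; occ-pruned = λ j → trans (occ-pruned R j)
        (sym (cong (_∨ occ (punchIn i j) r) (punchIn-absent l pl j)))
    ; node-pruned = λ q′ → let q , same = node-pruned R q′ in goR q , same }
    where
    R : Pruned r r′
    R = prune-just r pr
  prune-just (nd l r) refl | just l′ | just r′ = record
    { count-pruned = λ j → cong₂ _+_ (count-pruned L j) (count-pruned R j)
    ; occ-pruned = occ-root
    ; node-pruned = λ where
        here → here , occ-root
        (goL q′) → let q , same = node-pruned L q′ in goL q , same
        (goR q′) → let q , same = node-pruned R q′ in goR q , same }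
    where
    L : Pruned l l′
    L = prune-just l pl
    R : Pruned r r′
    R = prune-just r pr
    occ-root : ∀ j → occ j l′ ∨ occ j r′ ≡ occ (punchIn i j) l ∨ occ (punchIn i j) r
    occ-root j = cong₂ _∨_ (occ-pruned L j) (occ-pruned R j)

record Compression {mm : ℕ} (p : Fin n → Fin mm) (D : BT (Fin mm)) : Set where
  field
    partition : Partition n
    embed : Fin (m partition) → Fin mm
    embed-part : ∀ v → embed (part partition v) ≡ p v
    embed-injective : ∀ {j j′} → embed j ≡ embed j′ → j ≡ j′
    sumF-embed≤ : ∀ (g : Fin mm → ℕ) → sumF (g ∘ embed) ≤ sumF g
    tree : BT (Fin (m partition))
    tree-bij : ∀ j → count j tree ≡ 1
    tree-node : ∀ (q′ : Pos tree) → Σ (Pos D) (λ q → ∀ j → occ j (sub q′) ≡ occ (embed j) (sub q))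

-- The vertex v₀ keeps its label in the tree, so pruning never empties it.
compress : ∀ {mm} (p : Fin n → Fin mm) (D : BT (Fin mm)) → (∀ i → count i D ≡ 1) → Fin n → Compression p D
compress {mm = mm} p D D-bij v₀ with all? (λ i → any? (λ v → p v ≟ i))
... | yes surjective = record
  { partition = record { m = mm ; part = p ; surj = surjective }
  ; embed = id
  ; embed-part = λ _ → refl
  ; embed-injective = id
  ; sumF-embed≤ = λ _ → ≤-refl
  ; tree = D
  ; tree-bij = D-bij
  ; tree-node = λ q → q , λ _ → refl }
compress {mm = zero} p D D-bij v₀ | no ¬surjective = ⊥-elim (¬surjective (λ ()))
compress {mm = suc mm} p D D-bij v₀ | no ¬surjective
  with ¬∀⟶∃¬ _ _ (λ i → any? (λ v → p v ≟ i)) ¬surjective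
... | i , unused with Prune.prune i D in pruned
...   | nothing =
  ⊥-elim (unused (v₀ , Prune.prune-nothing i D pruned (p v₀) (count≡1⇒occ D (p v₀) (D-bij (p v₀)))))
...   | just D′ = record
  { partition = partition C
  ; embed = punchIn i ∘ embed C
  ; embed-part = λ v → trans (cong (punchIn i) (embed-part C v)) (punchIn-punchOut (p≢i v))
  ; embed-injective = embed-injective C ∘ punchIn-injective i _ _
  ; sumF-embed≤ = λ g → ≤-trans (sumF-embed≤ C (g ∘ punchIn i))
                                (subst (sumF (g ∘ punchIn i) ≤_) (sym (sumF-punchIn g i)) (m≤n+m _ _))
  ; tree = tree C
  ; tree-bij = tree-bij C
  ; tree-node = λ q′ → let q″ , same′ = tree-node C q′
                           q , same = Prune.Pruned.node-pruned D-pruned q″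
                       in q , λ j → trans (same′ j) (same (embed C j)) }
  where
  open Compression
  D-pruned : Prune.Pruned i D D′
  D-pruned = Prune.prune-just i D pruned
  p≢i : ∀ v → i ≢ p v
  p≢i v i≡pv = unused (v , sym i≡pv)
  C : Compression (λ v → punchOut (p≢i v)) D′
  C = compress (λ v → punchOut (p≢i v)) D′
        (λ j → trans (Prune.Pruned.count-pruned D-pruned j) (D-bij (punchIn i j))) v₀

-- Uncrossing

module _ (G : Graph n) where

  cutrk-cong : ∀ {A B} → A ≐ B → cutrk G A ≡ cutrk G B
  cutrk-cong = cutrkA-cong (E G)

  -- Edges inside a part never cross a union of parts.
  cutrk-quotient : (𝒟 : Partition n) (h : Fin (m 𝒟) → Bool) →
    cutrkA (quotAdj G 𝒟) (λ v → h (part 𝒟 v)) ≡ cutrk G (λ v → h (part 𝒟 v))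
  cutrk-quotient 𝒟 h = rk-cong _ _ same
    where
    same : ∀ u v → h (part 𝒟 u) ∧ not (h (part 𝒟 v)) ∧ (E G u v ∧ not (part 𝒟 u == part 𝒟 v))
                 ≡ h (part 𝒟 u) ∧ not (h (part 𝒟 v)) ∧ E G u v
    same u v with h (part 𝒟 u) in hu | h (part 𝒟 v) in hv
    ... | false | _ = refl
    ... | true | true = refl
    ... | true | false with part 𝒟 u == part 𝒟 v in u==v
    ...   | true = ⊥-elim (true≢false (trans (cong h (sym (==⇒≡ u==v))) hu) hv)
    ...   | false = ∧-identityʳ (E G u v)

  module _ {C L S : VSet n} (minimiser-S : MinimiserBetween (cutrk G) C L S) where

    private
      C⊆S : C ⊆ S
      C⊆S = proj₁ minimiser-S
      S⊆L : S ⊆ L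
      S⊆L = proj₁ (proj₂ minimiser-S)
      S-min : ∀ X → C ⊆ X → X ⊆ L → cutrk G S ≤ cutrk G X
      S-min = proj₂ (proj₂ minimiser-S)

    cutrk-∪-minimiser : ∀ U → C ⊆ U → cutrk G (U ∪ S) ≤ cutrk G U
    cutrk-∪-minimiser U C⊆U = +-cancelˡ-≤ (cutrk G S) _ _ (begin
      cutrk G S + cutrk G (U ∪ S)        ≤⟨ +-monoˡ-≤ _ (S-min (U ∩ S) C⊆U∩S (λ v → S⊆L v ∘ ∧-elimʳ {U v})) ⟩
      cutrk G (U ∩ S) + cutrk G (U ∪ S)  ≤⟨ cutrkA-submodular (E G) U S ⟩
      cutrk G U + cutrk G S              ≡⟨ +-comm (cutrk G U) _ ⟩
      cutrk G S + cutrk G U              ∎)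
      where
      open ≤-Reasoning
      C⊆U∩S : C ⊆ (U ∩ S)
      C⊆U∩S v Cv = ∧-intro (C⊆U v Cv) (C⊆S v Cv)

    cutrk-∖-minimiser : ∀ U → (∀ v → C v ≡ true → U v ≡ false) → cutrk G (U ∖ S) ≤ cutrk G U
    cutrk-∖-minimiser U C∩U≡∅ = +-cancelˡ-≤ (cutrk G S) _ _ (begin
      cutrk G S + cutrk G (U ∖ S)           ≤⟨ +-monoˡ-≤ _ (S-min (S ∖ U) C⊆S∖U (λ v → S⊆L v ∘ ∧-elimˡ)) ⟩
      cutrk G (S ∖ U) + cutrk G (U ∖ S)     ≡⟨ cong (_+ cutrk G (U ∖ S)) (cutrk-cong S∖U≐∁[U∪∁S]) ⟩
      cutrk G (∁ (U ∪ ∁ S)) + cutrk G (U ∖ S)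
        ≡⟨ cong (_+ cutrk G (U ∖ S)) (sym (cutrkA-∁ (E G) (Graph.sym G) (U ∪ ∁ S))) ⟩
      cutrk G (U ∪ ∁ S) + cutrk G (U ∩ ∁ S) ≡⟨ +-comm (cutrk G (U ∪ ∁ S)) _ ⟩
      cutrk G (U ∩ ∁ S) + cutrk G (U ∪ ∁ S) ≤⟨ cutrkA-submodular (E G) U (∁ S) ⟩
      cutrk G U + cutrk G (∁ S)             ≡⟨ cong (cutrk G U +_) (sym (cutrkA-∁ (E G) (Graph.sym G) S)) ⟩
      cutrk G U + cutrk G S                 ≡⟨ +-comm (cutrk G U) _ ⟩
      cutrk G S + cutrk G U                 ∎)
      where
      open ≤-Reasoning
      C⊆S∖U : C ⊆ (S ∖ U)
      C⊆S∖U v Cv = ∧-intro (C⊆S v Cv) (not-false (C∩U≡∅ v Cv))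
      S∖U≐∁[U∪∁S] : (S ∖ U) ≐ ∁ (U ∪ ∁ S)
      S∖U≐∁[U∪∁S] v with S v | U v
      ... | true | true = refl
      ... | true | false = refl
      ... | false | true = refl
      ... | false | false = refl

countWhere : ∀ {A : Set} → (A → Bool) → List A → ℕ
countWhere g = foldr (λ t acc → if g t then suc acc else acc) 0

module _ {A : Set} (g h : A → Bool) (g⇒h : ∀ x → g x ≡ true → h x ≡ true) where

  countWhere-mono : ∀ xs → countWhere g xs ≤ countWhere h xs
  countWhere-mono [] = z≤n
  countWhere-mono (x ∷ xs) with g x in gx | h x in hx
  ... | true | true = s≤s (countWhere-mono xs)
  ... | true | false = ⊥-elim (true≢false (g⇒h x gx) hx)
  ... | false | true = m≤n⇒m≤1+n (countWhere-mono xs)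
  ... | false | false = countWhere-mono xs

  countWhere-< : ∀ {t} xs → t ∈ xs → g t ≡ false → h t ≡ true → countWhere g xs < countWhere h xs
  countWhere-< (x ∷ xs) (here refl) gt ht rewrite gt | ht = s≤s (countWhere-mono xs)
  countWhere-< (x ∷ xs) (there t∈xs) gt ht with g x in gx | h x in hx
  ... | true | true = s≤s (countWhere-< xs t∈xs gt ht)
  ... | true | false = ⊥-elim (true≢false (g⇒h x gx) hx)
  ... | false | true = m≤n⇒m≤1+n (countWhere-< xs t∈xs gt ht)
  ... | false | false = countWhere-< xs t∈xs gt ht

module _ (G : Graph n) (𝒯 : RootedDecomp n) (Tp : LeaflessPrefix 𝒯) (𝒟 : Partition n) (u : Pos (T 𝒯)) where

  PartConstantOn : Set
  PartConstantOn = ∀ x y → Lv 𝒯 u x ≡ true → Lv 𝒯 u y ≡ true → part 𝒟 x ≡ part 𝒟 y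

  uncut⇒partConstantOn : closureCutsB G 𝒯 Tp 𝒟 u ≡ false → PartConstantOn
  uncut⇒partConstantOn uncut x y ux uy = sym (==⇒≡ y∈class-x)
    where
    class-x : VSet n
    class-x = cls 𝒟 (part 𝒟 x)
    x∈class : anyF (λ v → Lv 𝒯 u v ∧ class-x v) ≡ true
    x∈class = anyF⁺ _ x (∧-intro ux (==-refl (part 𝒟 x)))
    nothing-outside : anyF (λ v → Lv 𝒯 u v ∧ not (class-x v)) ≡ false
    nothing-outside with anyF (λ v → Lv 𝒯 u v ∧ not (class-x v)) in outside
    ... | false = refl
    ... | true = ⊥-elim (true≢false (anyF⁺ _ (part 𝒟 x) (∧-intro x∈class outside)) uncut)
    y∈class-x : class-x y ≡ true
    y∈class-x with class-x y in cy
    ... | true = refl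
    ... | false = ⊥-elim (true≢false (anyF⁺ _ y (∧-intro uy (not-false cy))) nothing-outside)

  partConstantOn⇒uncut : PartConstantOn → closureCutsB G 𝒯 Tp 𝒟 u ≡ false
  partConstantOn⇒uncut constant = ≢true λ cut →
    let i , cuts-i = anyF⁻ _ cut
        x , ux∧x∈i = anyF⁻ _ (∧-elimˡ cuts-i)
        y , uy∧y∉i = anyF⁻ _ (∧-elimʳ {anyF (λ v → Lv 𝒯 u v ∧ cls 𝒟 i v)} cuts-i)
        x∈i = ∧-elimʳ {Lv 𝒯 u x} ux∧x∈i
        y∉i = not-true (∧-elimʳ {Lv 𝒯 u y} uy∧y∉i)
    in true≢false (subst (λ z → (z == i) ≡ true) (constant x y (∧-elimˡ ux∧x∈i) (∧-elimˡ uy∧y∉i)) x∈i) y∉i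

module Uncrossing {n} (G : Graph n) (𝒯 : RootedDecomp n) (Tp : LeaflessPrefix 𝒯) (c k : ℕ) (𝒞 : Partition n)
  (small : IsSmall G 𝒯 Tp c 𝒞) (closure : IsClosure G 𝒯 Tp k 𝒞)
  (i₀ : Fin (m 𝒞)) {a : Pos (T 𝒯)} (app-a : Appendix Tp a) {S : VSet n}
  (S-min : MinimiserBetween (cutrk G) (cls 𝒞 i₀) (Lv 𝒯 a) S) where

  C : VSet n
  C = cls 𝒞 i₀

  C⊆S : C ⊆ S
  C⊆S = proj₁ S-min

  S⊆La : S ⊆ Lv 𝒯 a
  S⊆La = proj₁ (proj₂ S-min)

  relabel : Fin n → Fin (m 𝒞)
  relabel v = if S v then i₀ else part 𝒞 v

  newClass : Fin (m 𝒞) → VSet n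
  newClass j v = relabel v == j

  newClass-i₀ : newClass i₀ ≐ S
  newClass-i₀ v with S v in Sv
  ... | true = ==-refl i₀
  ... | false = ≢true (λ Cv → true≢false (C⊆S v Cv) Sv)

  newClass-⊆ : ∀ {j} → j ≢ i₀ → newClass j ⊆ cls 𝒞 j
  newClass-⊆ j≢i₀ v with S v
  ... | true = λ i₀==j → ⊥-elim (j≢i₀ (sym (==⇒≡ i₀==j)))
  ... | false = λ Cj → Cj

  newClass-∖ : ∀ {j} → j ≢ i₀ → newClass j ≐ (cls 𝒞 j ∖ S)
  newClass-∖ j≢i₀ v with S v
  ... | true = trans (≢⇒==-false (j≢i₀ ∘ sym)) (sym (∧-zeroʳ _))
  ... | false = sym (∧-identityʳ _)

  cutrk-relabel≤ : ∀ (h : Fin (m 𝒞) → Bool) → cutrk G (h ∘ relabel) ≤ cutrk G (h ∘ part 𝒞)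
  cutrk-relabel≤ h with h i₀ in hi₀
  ... | true = ≤-trans (≤-reflexive (cutrk-cong G relabel-∪))
                       (cutrk-∪-minimiser G S-min (h ∘ part 𝒞) C⊆U)
    where
    relabel-∪ : (h ∘ relabel) ≐ ((h ∘ part 𝒞) ∪ S)
    relabel-∪ v with S v
    ... | true = trans hi₀ (sym (∨-zeroʳ _))
    ... | false = sym (∨-identityʳ _)
    C⊆U : C ⊆ (h ∘ part 𝒞)
    C⊆U v Cv = trans (cong h (==⇒≡ Cv)) hi₀
  ... | false = ≤-trans (≤-reflexive (cutrk-cong G relabel-∖))
                        (cutrk-∖-minimiser G S-min (h ∘ part 𝒞) C∩U≡∅)
    where
    relabel-∖ : (h ∘ relabel) ≐ ((h ∘ part 𝒞) ∖ S)
    relabel-∖ v with S v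
    ... | true = trans hi₀ (sym (∧-zeroʳ _))
    ... | false = sym (∧-identityʳ _)
    C∩U≡∅ : ∀ v → C v ≡ true → h (part 𝒞 v) ≡ false
    C∩U≡∅ v Cv = trans (cong h (==⇒≡ Cv)) hi₀

  D : BT (Fin (m 𝒞))
  D = proj₁ (proj₂ closure)

  D-bij : ∀ i → count i D ≡ 1
  D-bij = proj₁ (proj₂ (proj₂ closure))

  D-width : ∀ q → cutrkA (quotAdj G 𝒞) (λ v → occ (part 𝒞 v) (sub q)) ≤ 2 * k
  D-width = proj₂ (proj₂ (proj₂ closure))

  compression : Compression relabel D
  compression = compress relabel D D-bij (proj₁ (surj 𝒞 i₀))

  open Compression compression

  𝒞′ : Partition n
  𝒞′ = partition

  cls′ : ∀ j → cls 𝒞′ j ≐ newClass (embed j)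
  cls′ j v = does-⇔
    (mk⇔ (λ same → trans (sym (embed-part v)) (cong embed same))
         (λ same → embed-injective (trans (embed-part v) same)))
    (part 𝒞′ v ≟ j) (relabel v ≟ embed j)

  part′-constant : ∀ {x y} → relabel x ≡ relabel y → part 𝒞′ x ≡ part 𝒞′ y
  part′-constant same = embed-injective (trans (embed-part _) (trans same (sym (embed-part _))))

  isClosure′ : IsClosure G 𝒯 Tp k 𝒞′
  isClosure′ = in-appendix , tree , tree-bij , width
    where
    in-appendix : ∀ j → Σ (Pos (T 𝒯)) (λ a′ → Appendix Tp a′ × (cls 𝒞′ j ⊆ Lv 𝒯 a′))
    in-appendix j with embed j ≟ i₀
    ... | yes j↦i₀ = a , app-a , λ v in-j →
      S⊆La v (trans (sym (newClass-i₀ v)) (subst (λ i → newClass i v ≡ true) j↦i₀ (trans (sym (cls′ j v)) in-j)))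
    ... | no j≢i₀ = let a′ , app′ , ⊆a′ = proj₁ closure (embed j)
                    in a′ , app′ , λ v in-j → ⊆a′ v (newClass-⊆ j≢i₀ v (trans (sym (cls′ j v)) in-j))
    width : ∀ (q′ : Pos tree) → cutrkA (quotAdj G 𝒞′) (λ v → occ (part 𝒞′ v) (sub q′)) ≤ 2 * k
    width q′ = let q , same = tree-node q′ in begin
      cutrkA (quotAdj G 𝒞′) (λ v → occ (part 𝒞′ v) (sub q′)) ≡⟨ cutrk-quotient G 𝒞′ (λ j → occ j (sub q′)) ⟩
      cutrk G (λ v → occ (part 𝒞′ v) (sub q′))
        ≡⟨ cutrk-cong G (λ v → trans (same (part 𝒞′ v)) (cong (λ i → occ i (sub q)) (embed-part v))) ⟩
      cutrk G (λ v → occ (relabel v) (sub q))               ≤⟨ cutrk-relabel≤ (λ i → occ i (sub q)) ⟩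
      cutrk G (λ v → occ (part 𝒞 v) (sub q))                ≡⟨ sym (cutrk-quotient G 𝒞 (λ i → occ i (sub q))) ⟩
      cutrkA (quotAdj G 𝒞) (λ v → occ (part 𝒞 v) (sub q))   ≤⟨ D-width q ⟩
      2 * k                                                  ∎
      where open ≤-Reasoning

  isSmall′ : IsSmall G 𝒯 Tp c 𝒞′
  isSmall′ a′ app′ = begin
    countF (λ j → subB (cls 𝒞′ j) La′)            ≤⟨ countF-mono _ _ nonempty-inside ⟩
    countF (inside ∘ embed)                        ≡⟨ countF≡sumF (inside ∘ embed) ⟩
    sumF (λ j → if inside (embed j) then 1 else 0) ≤⟨ sumF-embed≤ (λ i → if inside i then 1 else 0) ⟩
    sumF (λ i → if inside i then 1 else 0)         ≡⟨ sym (countF≡sumF inside) ⟩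
    countF inside                                  ≤⟨ countF-mono _ _ old-inside ⟩
    countF (λ i → subB (cls 𝒞 i) La′)              ≤⟨ small a′ app′ ⟩
    c                                              ∎
    where
    open ≤-Reasoning
    La′ : VSet n
    La′ = Lv 𝒯 a′
    inside : Fin (m 𝒞) → Bool
    inside i = anyF (newClass i) ∧ subB (newClass i) La′
    nonempty-inside : ∀ j → subB (cls 𝒞′ j) La′ ≡ true → inside (embed j) ≡ true
    nonempty-inside j j⊆La′ = let v , v∈j = surj 𝒞′ j in ∧-intro
      (anyF⁺ _ v (trans (sym (cls′ j v)) (trans (cong (part 𝒞′ v ==_) (sym v∈j)) (==-refl (part 𝒞′ v)))))
      (subB⁺ _ La′ (λ u u∈j → subB⁻ (cls 𝒞′ j) La′ j⊆La′ u (trans (cls′ j u) u∈j)))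
    old-inside : ∀ i → inside i ≡ true → subB (cls 𝒞 i) La′ ≡ true
    old-inside i ok with i ≟ i₀
    ... | yes refl = subB⁺ C La′ (λ v Cv →
          subB⁻ (newClass i₀) La′ (∧-elimʳ {anyF (newClass i₀)} ok) v (trans (newClass-i₀ v) (C⊆S v Cv)))
    ... | no i≢i₀ =
      let v , v-new = anyF⁻ (newClass i) (∧-elimˡ ok)
          aᵢ , appᵢ , i⊆aᵢ = proj₁ closure i
          v∈La′ = subB⁻ (newClass i) La′ (∧-elimʳ {anyF (newClass i)} ok) v v-new
          aᵢ≡a′ = appendix-overlap Tp appᵢ app′ v (i⊆aᵢ v (newClass-⊆ i≢i₀ v v-new)) v∈La′
      in subB⁺ (cls 𝒞 i) La′ (λ u u∈i → subst (λ x → Lv 𝒯 x u ≡ true) aᵢ≡a′ (i⊆aᵢ u u∈i))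

  isSmallClosure′ : IsSmallClosure G 𝒯 Tp c k 𝒞′
  isSmallClosure′ = isSmall′ , isClosure′

  totalCut′ : totalCut G 𝒯 Tp 𝒞′ + cutrk G C ≤ totalCut G 𝒯 Tp 𝒞 + cutrk G S
  totalCut′ = begin
    totalCut G 𝒯 Tp 𝒞′ + cutrk G C            ≡⟨ cong (_+ cutrk G C) (sumF-cong (λ j → cutrk-cong G (cls′ j))) ⟩
    sumF (F ∘ embed) + cutrk G C              ≤⟨ +-monoˡ-≤ (cutrk G C) (sumF-embed≤ F) ⟩
    sumF F + cutrk G C                        ≤⟨ sumF-replace F (cutrk G ∘ cls 𝒞) i₀ other-parts ⟩
    totalCut G 𝒯 Tp 𝒞 + F i₀                  ≡⟨ cong (totalCut G 𝒯 Tp 𝒞 +_) (cutrk-cong G newClass-i₀) ⟩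
    totalCut G 𝒯 Tp 𝒞 + cutrk G S             ∎
    where
    open ≤-Reasoning
    F : Fin (m 𝒞) → ℕ
    F i = cutrk G (newClass i)
    other-parts : ∀ j → j ≢ i₀ → F j ≤ cutrk G (cls 𝒞 j)
    other-parts j j≢i₀ = ≤-trans (≤-reflexive (cutrk-cong G (newClass-∖ j≢i₀)))
      (cutrk-∖-minimiser G S-min (cls 𝒞 j)
        (λ v Cv → ≢⇒==-false (λ v∈j → j≢i₀ (trans (sym v∈j) (==⇒≡ {i = part 𝒞 v} Cv)))))

  module _ {t : Pos (T 𝒯)} (C-cuts-t : cutsB G 𝒯 Tp C t ≡ true)
           (Lt⊆S : Lv 𝒯 t ⊆ S) (S⊆C∪Lt : S ⊆ (C ∪ Lv 𝒯 t)) where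

    -- x ∈ S and y ∉ S in the same old part force x ∈ 𝒯[t]; so u meets t, yet u
    -- can neither lie below t (then y ∈ S) nor above it (then u meets C ∌ y).
    no-straddle : ∀ u → PartConstantOn G 𝒯 Tp 𝒞 u → ∀ x y →
      Lv 𝒯 u x ≡ true → Lv 𝒯 u y ≡ true → S x ≡ true → S y ≡ false → ⊥
    no-straddle u constant x y ux uy Sx Sy = nested (occ-nested t u x (≤-reflexive (bij 𝒯 x)) x∈Lt ux)
      where
      y∉C : C y ≡ false
      y∉C = ≢true (λ Cy → true≢false (C⊆S y Cy) Sy)
      x∉C : C x ≡ false
      x∉C = trans (cong (_== i₀) (constant x y ux uy)) y∉C
      x∈Lt : Lv 𝒯 t x ≡ true
      x∈Lt with ∨-elim (S⊆C∪Lt x Sx)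
      ... | inj₁ Cx = ⊥-elim (true≢false Cx x∉C)
      ... | inj₂ tx = tx
      nested : Desc t u ⊎ Desc u t → ⊥
      nested (inj₁ t-below-u) =
        let z , tz∧Cz = anyF⁻ _ (∧-elimˡ C-cuts-t)
            uz = Lv-Desc Tp t-below-u z (∧-elimˡ tz∧Cz)
        in true≢false (trans (cong (_== i₀) (constant y z uy uz)) (∧-elimʳ {Lv 𝒯 t z} tz∧Cz)) y∉C
      nested (inj₂ u-below-t) = true≢false (Lt⊆S y (Lv-Desc Tp u-below-t y uy)) Sy

    relabel-constant : ∀ u → PartConstantOn G 𝒯 Tp 𝒞 u → ∀ x y →
      Lv 𝒯 u x ≡ true → Lv 𝒯 u y ≡ true → relabel x ≡ relabel y
    relabel-constant u constant x y ux uy with S x in Sx | S y in Sy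
    ... | true | true = refl
    ... | false | false = constant x y ux uy
    ... | true | false = ⊥-elim (no-straddle u constant x y ux uy Sx Sy)
    ... | false | true = ⊥-elim (no-straddle u constant y x uy ux Sy Sx)

    cut′⇒cut : ∀ u → closureCutsB G 𝒯 Tp 𝒞′ u ≡ true → closureCutsB G 𝒯 Tp 𝒞 u ≡ true
    cut′⇒cut u cut′ with closureCutsB G 𝒯 Tp 𝒞 u in cut
    ... | true = refl
    ... | false = ⊥-elim (true≢false cut′ (partConstantOn⇒uncut G 𝒯 Tp 𝒞′ u λ x y ux uy →
                    part′-constant (relabel-constant u (uncut⇒partConstantOn G 𝒯 Tp 𝒞 u cut) x y ux uy)))

    t-uncut′ : closureCutsB G 𝒯 Tp 𝒞′ t ≡ false
    t-uncut′ = partConstantOn⇒uncut G 𝒯 Tp 𝒞′ t λ x y tx ty →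
      part′-constant (trans (relabel-Lt x tx) (sym (relabel-Lt y ty)))
      where
      relabel-Lt : ∀ x → Lv 𝒯 t x ≡ true → relabel x ≡ i₀
      relabel-Lt x tx = cong (if_then i₀ else part 𝒞 x) (Lt⊆S x tx)

    nCut′< : nCut G 𝒯 Tp 𝒞′ < nCut G 𝒯 Tp 𝒞
    nCut′< = countWhere-< _ _ cut′⇒cut (allPos (T 𝒯)) (allPos-complete (T 𝒯) t) t-uncut′ (anyF⁺ _ i₀ C-cuts-t)

lemma5p3 : ∀ {n} (G : Graph n) (𝒯 : RootedDecomp n) (Tp : LeaflessPrefix 𝒯)
    (c k : ℕ) → 1 ≤ c → 1 ≤ k → (𝒞 : Partition n) →
    IsMinimalSmallClosure G 𝒯 Tp c k 𝒞 → IsLinked G 𝒯 Tp 𝒞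
lemma5p3 {n} G 𝒯 Tp c k _ _ 𝒞 ((small , closure) , minimal) i a app-a C⊆La = linked , strict
  where
  C La : VSet n
  C = cls 𝒞 i
  La = Lv 𝒯 a
  module U {S : VSet n} (S-min : MinimiserBetween (cutrk G) C La S) = Uncrossing G 𝒯 Tp c k 𝒞 small closure i app-a S-min

  C≤minimiser : ∀ {S} → MinimiserBetween (cutrk G) C La S → cutrk G C ≤ cutrk G S
  C≤minimiser S-min = +-cancelˡ-≤ (totalCut G 𝒯 Tp 𝒞) _ _
    (≤-trans (+-monoˡ-≤ (cutrk G C) (proj₁ (minimal (U.𝒞′ S-min) (U.isSmallClosure′ S-min)))) (U.totalCut′ S-min))

  linked : LinkedInto G 𝒯 Tp C La
  linked S C⊆S S⊆La = let S* , S*-min = minimiser-between (cutrk G) (cutrk-cong G) C⊆S S⊆La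
                      in ≤-trans (C≤minimiser S*-min) (proj₂ (proj₂ S*-min) S C⊆S S⊆La)

  strict : ∀ t → Desc t a → cutsB G 𝒯 Tp C t ≡ true → cutrk G C < cutrk G (C ∪ Lv 𝒯 t)
  strict t t≤a C-cuts-t = ≰⇒> λ no-gain →
    let S-min = (λ _ → ∨-introˡ) , (λ v → [ C⊆La v , Lv-Desc Tp t≤a v ] ∘ ∨-elim) ,
                λ X C⊆X X⊆La → ≤-trans no-gain (linked X C⊆X X⊆La)
        no-better , tie-break = minimal (U.𝒞′ S-min) (U.isSmallClosure′ S-min)
        same-total = ≤-antisym no-better
          (+-cancelʳ-≤ _ _ _ (≤-trans (U.totalCut′ S-min) (+-monoʳ-≤ _ no-gain)))
    in <⇒≱ (U.nCut′< S-min {t = t} C-cuts-t (λ _ → ∨-introʳ) (λ _ → id)) (tie-break same-total)
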